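{- Let $\beta>0$ and let $G$ be a weakly $(n,\beta)$-graph on $n$ vertices. Then $$\alpha'(G)\ge \min\left\{\frac{1-\beta}{1+\beta},\ \frac{1}{2}\right\}\cdot (n-1).$$ In particular, if $n$ is even and $0<\beta\le 1/3$, then $G$ has a perfect matching.
   Context: All graphs are finite, simple and nonempty. $\alpha'(G)$ denotes the matching number (maximum size of a matching). For vertex sets $X,Y$, $e(X,Y)$ is the number of edges with one end in $X$ and the other in $Y$ (edges with both ends in $X\cap Y$ counted twice). For $\beta>0$, a graph $G$ on $n$ vertices is a weakly $(n,\beta)$-graph if $\frac{|X||Y|}{(n-|X|)(n-|Y|)}\le\beta^2$ for every pair of disjoint proper subsets $X,Y$ of $V(G)$ with no edge between $X$ and $Y$.
   Formalization: The parameter β ranges over the positive rationals. -}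

module Defs where

open import Data.Nat as ℕ using (ℕ; _∸_)
open import Data.Bool using (Bool; true; false)
open import Data.Fin using (Fin; splitAt)
open import Data.Fin.Subset using (Subset; _∈_; _∉_; ∣_∣; ⊤)
open import Data.Integer using (+_)
open import Data.Rational using (ℚ; 0ℚ; 1ℚ; ½; _+_; _-_; _*_; _÷_; _⊓_; _≤_; _<_; _/_; Positive; positive)
open import Data.Rational.Properties using (pos⇒nonZero)
open import Data.Rational.Properties using (pos+pos⇒pos)
open import Data.Sum using ([_,_])
open import Data.Product using (Σ; _×_)
open import Function using (_∘_)
open import Function.Definitions using (Injective)
open import Relation.Binary.PropositionalEquality using (_≡_; _≢_)

record Graph (n : ℕ) : Set where
  field
    Adj    : Fin n → Fin n → Bool
    sym    : ∀ i j → Adj i j ≡ Adj j i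
    irrefl : ∀ i → Adj i i ≡ false
open Graph public

↑ : ℕ → ℚ
↑ m = + m / 1

-- A matching of size k in G: k edges u i — v i whose 2k endpoints are
-- pairwise distinct.
record Matching {n : ℕ} (G : Graph n) (k : ℕ) : Set where
  field
    u v      : Fin k → Fin n
    isEdge   : ∀ i → Adj G (u i) (v i) ≡ true
    disjoint : Injective _≡_ _≡_ ([ u , v ] ∘ splitAt k)

-- α'(G) ≥ c  (α' is the maximum size of a matching, so this holds iff
-- some matching has size ≥ c).
MatchingNumberAtLeast : {n : ℕ} → Graph n → ℚ → Set
MatchingNumberAtLeast G c = Σ ℕ λ k → Matching G k × (c ≤ ↑ k)

-- G is a weakly (n,β)-graph: for all disjoint proper subsets X, Y with no
-- edge between them, |X||Y| / ((n-|X|)(n-|Y|)) ≤ β² (denominator is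
-- positive since X, Y are proper, so stated multiplied out).
WeaklyGraph : (n : ℕ) → Graph n → ℚ → Set
WeaklyGraph n G β =
  ∀ (X Y : Subset n) → X ≢ ⊤ → Y ≢ ⊤ →
  (∀ i → i ∈ X → i ∉ Y) →
  (∀ i j → i ∈ X → j ∈ Y → Adj G i j ≡ false) →
  ↑ (∣ X ∣ ℕ.* ∣ Y ∣) ≤ (β * β) * ↑ ((n ∸ ∣ X ∣) ℕ.* (n ∸ ∣ Y ∣))

bound : (β : ℚ) → 0ℚ < β → ℚ
bound β 0<β = ((1ℚ - β) ÷ (1ℚ + β)) {{nz}} ⊓ ½
  where
    instance
      posβ : Positive β
      posβ = positive 0<β
    nz = pos⇒nonZero (1ℚ + β) {{pos+pos⇒pos 1ℚ β}}

{-# OPTIONS --safe #-}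
module Submission where

-- Adding j = n + 1 − 2(r + 1) universal vertices to G, a perfect matching of the larger graph gives a
-- matching of size r + 1 in G; otherwise Tutte's theorem gives a set S whose removal leaves at least
-- |S| + 2 odd classes.  The new vertices lie in S, and splitting the odd classes of G − S into two halves
-- gives sets X, Y without edges between them, each with at least (s + j + 1)/2 vertices, where
-- s = |S ∩ V(G)| ≤ r.  Then x/(s + x) and y/(s + y) are at least (n − r)/(n + r), so the weak condition
-- xy ≤ β²(s + x)(s + y) forces (n − r)/(n + r) ≤ β, i.e. r ≥ (1 − β)/(1 + β)·n.  Decreasing r from
-- r + 1 = ⌊(n + 1)/2⌋ ≥ n/2, the first success gives a matching of size r + 1, and each failure shows
-- that the bound holds for r.

open import Defs hiding (sym; irrefl)
open import Data.Bool as Bool using (Bool; true; false; not; _∧_; _∨_; _xor_; if_then_else_)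
open import Data.Bool.Properties
  using ( ∨-zeroʳ; ∧-identityʳ; ∧-zeroʳ; ∧-assoc; not-involutive; ¬-not; not-¬; not-injective
        ; not-distribˡ-xor; xor-same; xor-identityʳ)
open import Data.Empty using (⊥; ⊥-elim)
open import Data.Fin using (Fin; zero; suc; toℕ; _↑ˡ_; _↑ʳ_; splitAt; join; inject≤)
open import Data.Fin.Properties
  using (_≟_; any?; all?; ¬∀⟶∃¬; pigeonhole; toℕ<n; splitAt-↑ˡ; splitAt-↑ʳ; join-splitAt; inject≤-injective)
open import Data.Nat as ℕ using (ℕ; zero; suc; _+_; _*_; _∸_; _≤_; _<_; z≤n; s≤s; z<s)
open import Data.Nat.Properties hiding (_≟_)
open import Algebra.Properties.CommutativeMonoid.Sum +-0-commutativeMonoid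
  using (sum; sum-cong-≗; ∑-distrib-+; ∑-comm; sum-permute)
open import Data.Fin.Permutation using (permutation)
open import Data.Vec.Functional using (_∷_)
open import Data.Fin.Subset using (_∈_; ∣_∣; ⊤)
open import Data.Vec using (tabulate; lookup)
open import Data.Vec.Properties using (lookup∘tabulate; []=⇒lookup; lookup-replicate)
import Data.Integer as ℤ
import Data.Integer.Properties as ℤ
import Data.Rational as ℚ
import Data.Rational.Properties as ℚ
open import Data.Rational using (ℚ; 0ℚ; 1ℚ; ½; mkℚ; 1/_; Positive; NonNegative; NonZero; positive; nonNegative)
open import Data.Rational.Solver using (module +-*-Solver)
open import Data.Nat.Tactic.RingSolver using (solve-∀)
open import Data.Nat.Coprimality as Coprime using (1-coprimeTo)
open import Data.Product using (Σ; ∃; ∃-syntax; _×_; _,_; proj₁; proj₂)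
open import Data.Sum as Sum using (_⊎_; inj₁; inj₂; [_,_])
open import Data.Sum.Properties using (inj₁-injective; inj₂-injective)
open import Data.Maybe as Maybe using (Maybe; just; nothing; fromMaybe)
open import Function using (_∘_; const; _⇔_; mk⇔; Equivalence)
open import Function.Definitions using (Injective)
open import Relation.Nullary using (¬_; Dec; yes; no; does; contradiction)
open import Relation.Nullary.Decidable using (dec-true; dec-false; _×-dec_; _⊎-dec_; ¬?)
open import Relation.Unary using (Decidable)
open import Relation.Binary.Definitions using (tri<; tri≈; tri>)
open import Induction.WellFounded using (module All)
open import Data.Nat.Induction using (<-wellFounded)
import Relation.Binary.Construct.On as On
open import Relation.Binary.PropositionalEquality
  using (_≡_; _≢_; refl; sym; trans; cong; cong₂; subst; subst₂; module ≡-Reasoning)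

private
  variable
    m n N j : ℕ

-- Counting, parity and search

⟦_⟧ : Bool → ℕ
⟦ true ⟧ = 1
⟦ false ⟧ = 0

count : (Fin m → Bool) → ℕ
count P = sum (λ i → ⟦ P i ⟧)

_==_ : Fin m → Fin m → Bool
i == j = does (i ≟ j)

==-refl : (i : Fin m) → (i == i) ≡ true
==-refl i = dec-true (i ≟ i) refl

==⇒≡ : {i j : Fin m} → (i == j) ≡ true → i ≡ j
==⇒≡ {i = i} {j} eq with i ≟ j
... | yes i≡j = i≡j

≢⇒==-false : {i j : Fin m} → i ≢ j → (i == j) ≡ false
≢⇒==-false {i = i} {j} = dec-false (i ≟ j)

==-dec-false⁻≢ : {i j : Fin m} → (i == j) ≡ false → i ≢ j
==-dec-false⁻≢ {i = i} eq refl with () ← trans (sym (==-refl i)) eq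

∧-true⁻ : ∀ {a b} → a ∧ b ≡ true → a ≡ true × b ≡ true
∧-true⁻ {true} b≡true = refl , b≡true

not-true⁻ : ∀ {a} → not a ≡ true → a ≡ false
not-true⁻ {false} _ = refl

remove : (Fin m → Bool) → Fin m → Fin m → Bool
remove W i k = not (k == i) ∧ W k

remove-⊆ : (W : Fin m → Bool) {i k : Fin m} → remove W i k ≡ true → W k ≡ true
remove-⊆ W = proj₂ ∘ ∧-true⁻

remove-≢ : (W : Fin m → Bool) {i k : Fin m} → remove W i k ≡ true → k ≢ i
remove-≢ W = ==-dec-false⁻≢ ∘ not-true⁻ ∘ proj₁ ∘ ∧-true⁻

remove-intro : (W : Fin m → Bool) {i k : Fin m} → k ≢ i → W k ≡ true → remove W i k ≡ true
remove-intro W k≢i Wk rewrite ≢⇒==-false k≢i = Wk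

count-cong : {P Q : Fin m → Bool} → (∀ i → P i ≡ Q i) → count P ≡ count Q
count-cong P≗Q = sum-cong-≗ (cong ⟦_⟧ ∘ P≗Q)

count-none : {P : Fin m → Bool} → (∀ i → P i ≡ false) → count P ≡ 0
count-none {zero} none = refl
count-none {suc m} none rewrite none zero = count-none (none ∘ suc)

count-all : count {m} (λ _ → true) ≡ m
count-all {zero} = refl
count-all {suc m} = cong suc count-all

count-remove : (W : Fin m → Bool) (i : Fin m) → count W ≡ count (remove W i) + ⟦ W i ⟧
count-remove {suc m} W zero = +-comm ⟦ W zero ⟧ _
count-remove {suc m} W (suc i) = begin
  ⟦ W zero ⟧ + count (W ∘ suc)                                      ≡⟨ cong (⟦ W zero ⟧ +_) (count-remove (W ∘ suc) i) ⟩
  ⟦ W zero ⟧ + (count (remove (W ∘ suc) i) + ⟦ W (suc i) ⟧)        ≡⟨ +-assoc ⟦ W zero ⟧ _ _ ⟨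
  ⟦ W zero ⟧ + count (remove (W ∘ suc) i) + ⟦ W (suc i) ⟧          ∎
  where open ≡-Reasoning

count-remove₂ : (V : Fin m → Bool) {i j : Fin m} → j ≢ i →
  count V ≡ count (remove (remove V i) j) + ⟦ V j ⟧ + ⟦ V i ⟧
count-remove₂ V {i} {j} j≢i = begin
  count V                                                      ≡⟨ count-remove V i ⟩
  count (remove V i) + ⟦ V i ⟧                                 ≡⟨ cong (_+ ⟦ V i ⟧) (count-remove (remove V i) j) ⟩
  count (remove (remove V i) j) + ⟦ remove V i j ⟧ + ⟦ V i ⟧
    ≡⟨ cong (λ b → count (remove (remove V i) j) + ⟦ not b ∧ V j ⟧ + ⟦ V i ⟧)
                                                                       (≢⇒==-false j≢i) ⟩
  count (remove (remove V i) j) + ⟦ V j ⟧ + ⟦ V i ⟧            ∎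
  where open ≡-Reasoning

count-remove₂-∧ : (W X : Fin m → Bool) {i j : Fin m} → W i ≡ true → W j ≡ true → j ≢ i →
  count (λ k → W k ∧ X k) ≡ count (λ k → remove (remove W i) j k ∧ X k) + ⟦ X j ⟧ + ⟦ X i ⟧
count-remove₂-∧ W X {i} {j} Wi Wj j≢i =
  trans (count-remove₂ (λ k → W k ∧ X k) j≢i)
        (cong₂ _+_ (cong₂ _+_ (count-cong reassoc) (cong (λ v → ⟦ v ∧ X j ⟧) Wj)) (cong (λ v → ⟦ v ∧ X i ⟧) Wi))
  where
    reassoc : ∀ k → remove (remove (λ k → W k ∧ X k) i) j k ≡ remove (remove W i) j k ∧ X k
    reassoc k = trans (cong (not (k == j) ∧_) (sym (∧-assoc (not (k == i)) (W k) (X k))))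
                      (sym (∧-assoc (not (k == j)) _ (X k)))

count-remove₂-< : (W : Fin m → Bool) {i j : Fin m} → W i ≡ true → W j ≡ true → j ≢ i →
  count (remove (remove W i) j) < count W
count-remove₂-< W {i} {j} Wi Wj j≢i = begin-strict
  count (remove (remove W i) j)                       ≤⟨ m≤m+n _ _ ⟩
  count (remove (remove W i) j) + ⟦ W j ⟧             <⟨ m<m+n _ (subst (λ b → 0 < ⟦ b ⟧) (sym Wi) z<s) ⟩
  count (remove (remove W i) j) + ⟦ W j ⟧ + ⟦ W i ⟧  ≡⟨ count-remove₂ W j≢i ⟨
  count W                                             ∎
  where open ≤-Reasoning

count-flip : {P Q : Fin m → Bool} (c : Fin m) → (∀ k → k ≢ c → P k ≡ Q k) → P c ≡ true → Q c ≡ false →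
  count P ≡ suc (count Q)
count-flip {P = P} {Q} c agree Pc Qc = begin
  count P                         ≡⟨ count-remove P c ⟩
  count (remove P c) + ⟦ P c ⟧    ≡⟨ cong₂ _+_ (count-cong removed) (cong ⟦_⟧ Pc) ⟩
  count (remove Q c) + 1          ≡⟨ +-comm _ 1 ⟩
  suc (count (remove Q c))        ≡⟨ cong suc (+-identityʳ _) ⟨
  suc (count (remove Q c) + 0)    ≡⟨ cong (λ b → suc (count (remove Q c) + ⟦ b ⟧)) Qc ⟨
  suc (count (remove Q c) + ⟦ Q c ⟧) ≡⟨ cong suc (count-remove Q c) ⟨
  suc (count Q)                   ∎
  where
    open ≡-Reasoning
    removed : ∀ k → remove P c k ≡ remove Q c k
    removed k with k ≟ c
    ... | yes _ = refl
    ... | no k≢c = agree k k≢c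

count-witness : {P : Fin m → Bool} → 0 < count P → ∃[ i ] P i ≡ true
count-witness {P = P} 0<count with any? (λ i → P i Bool.≟ true)
... | yes witness = witness
... | no none = contradiction (sym (count-none (λ i → ¬-not (none ∘ (i ,_))))) (<⇒≢ 0<count)

witness⇒count-pos : (P : Fin m → Bool) {i : Fin m} → P i ≡ true → 0 < count P
witness⇒count-pos P {i} Pi = begin
  1                              ≡⟨ cong ⟦_⟧ Pi ⟨
  ⟦ P i ⟧                        ≤⟨ m≤n+m _ _ ⟩
  count (remove P i) + ⟦ P i ⟧   ≡⟨ count-remove P i ⟨
  count P                        ∎
  where open ≤-Reasoning

count-at-most-one : {P : Fin m → Bool} (i : Fin m) → (∀ k → k ≢ i → P k ≡ false) → count P ≤ 1
count-at-most-one {P = P} i others = begin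
  count P                        ≡⟨ count-remove P i ⟩
  count (remove P i) + ⟦ P i ⟧   ≡⟨ cong (_+ ⟦ P i ⟧) (count-none removed) ⟩
  ⟦ P i ⟧                        ≤⟨ indicator≤1 (P i) ⟩
  1                              ∎
  where
    open ≤-Reasoning
    removed : ∀ k → remove P i k ≡ false
    removed k with k ≟ i
    ... | yes _ = refl
    ... | no k≢i = others k k≢i
    indicator≤1 : ∀ b → ⟦ b ⟧ ≤ 1
    indicator≤1 true = ≤-refl
    indicator≤1 false = z≤n

count-split : (A B : Fin m → Bool) → count (λ i → A i ∧ B i) + count (λ i → A i ∧ not (B i)) ≡ count A
count-split A B = trans (sym (∑-distrib-+ (λ i → ⟦ A i ∧ B i ⟧) _)) (sum-cong-≗ split)
  where
    split : ∀ i → ⟦ A i ∧ B i ⟧ + ⟦ A i ∧ not (B i) ⟧ ≡ ⟦ A i ⟧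
    split i with A i | B i
    ... | true | true = refl
    ... | true | false = refl
    ... | false | _ = refl

sum-mono-≤ : {f g : Fin m → ℕ} → (∀ i → f i ≤ g i) → sum f ≤ sum g
sum-mono-≤ {zero} f≤g = z≤n
sum-mono-≤ {suc m} f≤g = +-mono-≤ (f≤g zero) (sum-mono-≤ (f≤g ∘ suc))

sum-mono-< : {f g : Fin m → ℕ} → (∀ i → f i ≤ g i) → (i : Fin m) → f i < g i → sum f < sum g
sum-mono-< f≤g zero fi<gi = +-mono-<-≤ fi<gi (sum-mono-≤ (f≤g ∘ suc))
sum-mono-< f≤g (suc i) fi<gi = +-mono-≤-< (f≤g zero) (sum-mono-< (f≤g ∘ suc) i fi<gi)

count-mono : {P Q : Fin m → Bool} → (∀ i → P i ≡ true → Q i ≡ true) → count P ≤ count Q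
count-mono {P = P} {Q} P⊆Q = sum-mono-≤ pointwise
  where
    pointwise : ∀ i → ⟦ P i ⟧ ≤ ⟦ Q i ⟧
    pointwise i with P i in eq
    ... | false = z≤n
    ... | true rewrite P⊆Q i eq = ≤-refl

sum-++ : ∀ {N j} (f : Fin (N + j) → ℕ) → sum f ≡ sum (f ∘ (_↑ˡ j)) + sum (f ∘ (N ↑ʳ_))
sum-++ {zero} f = refl
sum-++ {suc N} {j} f = trans (cong (f zero +_) (sum-++ {N} {j} (f ∘ suc))) (sym (+-assoc (f zero) _ _))

sum-indicator-== : (x : Fin m) (b : Bool) → sum (λ c → ⟦ b ∧ (x == c) ⟧) ≡ ⟦ b ⟧
sum-indicator-== x b = begin
  count (λ c → b ∧ (x == c))                                  ≡⟨ count-remove _ x ⟩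
  count (remove (λ c → b ∧ (x == c)) x) + ⟦ b ∧ (x == x) ⟧
    ≡⟨ cong₂ (λ n v → n + ⟦ b ∧ v ⟧) (count-none elsewhere) (==-refl x) ⟩
  ⟦ b ∧ true ⟧                                                ≡⟨ cong ⟦_⟧ (∧-identityʳ b) ⟩
  ⟦ b ⟧                                                       ∎
  where
    open ≡-Reasoning
    elsewhere : ∀ c → remove (λ c → b ∧ (x == c)) x c ≡ false
    elsewhere c with c ≟ x
    ... | yes _ = refl
    ... | no c≢x rewrite ≢⇒==-false (c≢x ∘ sym) = ∧-zeroʳ b

count-involution : {P : Fin m → Bool} (p : Fin m → Fin m) → (∀ i → p (p i) ≡ i) → count P ≡ count (P ∘ p)
count-involution {P = P} p involutive = sum-permute (λ i → ⟦ P i ⟧) (permutation p p involutive involutive)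

odd : ℕ → Bool
odd zero = false
odd (suc n) = not (odd n)

odd-+ : ∀ a b → odd (a + b) ≡ odd a xor odd b
odd-+ zero b = refl
odd-+ (suc a) b = trans (cong not (odd-+ a b)) (not-distribˡ-xor (odd a) (odd b))

odd-double : ∀ n → odd (n + n) ≡ false
odd-double n = trans (odd-+ n n) (xor-same (odd n))

odd-+-twice : ∀ x y → odd (x + y + y) ≡ odd x
odd-+-twice x y = begin
  odd (x + y + y)          ≡⟨ cong odd (+-assoc x y y) ⟩
  odd (x + (y + y))        ≡⟨ odd-+ x (y + y) ⟩
  odd x xor odd (y + y)    ≡⟨ cong (odd x xor_) (odd-double y) ⟩
  odd x xor false          ≡⟨ xor-identityʳ (odd x) ⟩
  odd x                    ∎
  where open ≡-Reasoning

odd-sum : (f : Fin m → ℕ) → odd (sum f) ≡ odd (count (odd ∘ f))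
odd-sum {zero} f = refl
odd-sum {suc m} f = begin
  odd (f zero + sum (f ∘ suc))                    ≡⟨ odd-+ (f zero) _ ⟩
  odd (f zero) xor odd (sum (f ∘ suc))            ≡⟨ cong₂ _xor_ (odd-indicator (odd (f zero))) (sym (odd-sum (f ∘ suc))) ⟨
  odd ⟦ odd (f zero) ⟧ xor odd (count (odd ∘ f ∘ suc))  ≡⟨ odd-+ ⟦ odd (f zero) ⟧ _ ⟨
  odd (count (odd ∘ f))                           ∎
  where
    open ≡-Reasoning
    odd-indicator : ∀ b → odd ⟦ b ⟧ ≡ b
    odd-indicator true = refl
    odd-indicator false = refl

odd⇒pos : ∀ {n} → odd n ≡ true → 0 < n
odd⇒pos {suc n} _ = z<s

same-parity-gap : ∀ {a b} → a < b → odd a ≡ odd b → 2 + a ≤ b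
same-parity-gap {a} (s≤s a≤b′) same with m≤n⇒m<n∨m≡n a≤b′
... | inj₁ a<b′ = s≤s a<b′
... | inj₂ refl = contradiction same (not-¬ refl)

double-≤-cancel : ∀ {a b} → a + a ≤ b + b → a ≤ b
double-≤-cancel a+a≤b+b = ≮⇒≥ (λ b<a → <⇒≱ (+-mono-< b<a b<a) a+a≤b+b)

n≤1+⌊n/2⌋+⌊n/2⌋ : ∀ n → n ≤ suc (ℕ.⌊ n /2⌋ + ℕ.⌊ n /2⌋)
n≤1+⌊n/2⌋+⌊n/2⌋ zero = z≤n
n≤1+⌊n/2⌋+⌊n/2⌋ (suc zero) = ≤-refl
n≤1+⌊n/2⌋+⌊n/2⌋ (suc (suc n)) rewrite +-suc ℕ.⌊ n /2⌋ ℕ.⌊ n /2⌋ = s≤s (s≤s (n≤1+⌊n/2⌋+⌊n/2⌋ n))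

measure-rec : {A : Set} (μ : A → ℕ) (P : A → Set) → (∀ x → (∀ y → μ y < μ x → P y) → P x) → ∀ x → P x
measure-rec μ P step = All.wfRec (On.wellFounded μ <-wellFounded) _ P (λ x rec → step x (λ y → rec))

search : {P : ℕ → Set} → Decidable P → ∀ n →
  (∃[ k ] k ≤ n × P k × (∀ i → i < k → ¬ P i)) ⊎ (∀ k → k ≤ n → ¬ P k)
search P? zero with P? 0
... | yes P0 = inj₁ (0 , z≤n , P0 , λ _ ())
... | no ¬P0 = inj₂ λ { zero _ → ¬P0 }
search P? (suc n) with P? 0
... | yes P0 = inj₁ (0 , z≤n , P0 , λ _ ())
... | no ¬P0 with search (P? ∘ suc) n
...   | inj₁ (k , k≤n , Pk , below) =
  inj₁ (suc k , s≤s k≤n , Pk , λ { zero _ → ¬P0 ; (suc i) (s≤s i<k) → below i i<k })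
...   | inj₂ none = inj₂ λ { zero _ → ¬P0 ; (suc k) (s≤s k≤n) → none k k≤n }

dec-true⁻ : {A : Set} (a? : Dec A) → does a? ≡ true → A
dec-true⁻ (yes a) _ = a

dec-false⁻ : {A : Set} (a? : Dec A) → does a? ≡ false → ¬ A
dec-false⁻ (no ¬a) _ = ¬a

firstTrue : (Fin m → Bool) → Maybe (Fin m)
firstTrue {zero} P = nothing
firstTrue {suc m} P = if P zero then just zero else Maybe.map suc (firstTrue (P ∘ suc))

firstTrue-cong : {P Q : Fin m → Bool} → (∀ i → P i ≡ Q i) → firstTrue P ≡ firstTrue Q
firstTrue-cong {zero} P≗Q = refl
firstTrue-cong {suc m} P≗Q rewrite P≗Q zero | firstTrue-cong (P≗Q ∘ suc) = refl

firstTrue-sound : (P : Fin m → Bool) {j : Fin m} → firstTrue P ≡ just j → P j ≡ true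
firstTrue-sound {suc m} P eq with P zero in P0 | firstTrue (P ∘ suc) in rest
firstTrue-sound {suc m} P refl | true | _ = P0
firstTrue-sound {suc m} P refl | false | just j = firstTrue-sound (P ∘ suc) rest

firstTrue-complete : (P : Fin m → Bool) {i : Fin m} → P i ≡ true → ∃[ j ] firstTrue P ≡ just j
firstTrue-complete {suc m} P {i} Pi with P zero in P0
... | true = zero , refl
firstTrue-complete {suc m} P {zero} Pi | false with () ← trans (sym Pi) P0
firstTrue-complete {suc m} P {suc i} Pi | false with j , eq ← firstTrue-complete (P ∘ suc) Pi rewrite eq = suc j , refl

-- Matchings

adj-sym : (G : Graph m) {i j : Fin m} → Adj G i j ≡ true → Adj G j i ≡ true
adj-sym G {i} {j} = trans (Graph.sym G j i)

adj⇒≢ : (G : Graph m) {i j : Fin m} → Adj G i j ≡ true → i ≢ j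
adj⇒≢ G {i} adj refl with () ← trans (sym adj) (Graph.irrefl G i)

record PerfectMatching (G : Graph m) : Set where
  field
    partner : Fin m → Fin m
    partner-involutive : ∀ i → partner (partner i) ≡ i
    partner-adjacent : ∀ i → Adj G i (partner i) ≡ true
open PerfectMatching

PerfectOn : Graph m → (Fin m → Bool) → (Fin m → Fin m) → Set
PerfectOn G W p = ∀ i → W i ≡ true → W (p i) ≡ true × p (p i) ≡ i × Adj G i (p i) ≡ true

perfectOn-cong : {G : Graph m} {W W′ : Fin m → Bool} {p : Fin m → Fin m} →
  (∀ i → W i ≡ W′ i) → PerfectOn G W p → PerfectOn G W′ p
perfectOn-cong {W = W} {W′} {p} W≗W′ perfect i W′i
  with W∘p , involutive , adjacent ← perfect i (trans (W≗W′ i) W′i) =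
  trans (sym (W≗W′ (p i))) W∘p , involutive , adjacent

matchPair : Fin m → Fin m → (Fin m → Fin m) → Fin m → Fin m
matchPair i j p k = if k == i then j else if k == j then i else p k

matchPair-left : (i j : Fin m) (p : Fin m → Fin m) → matchPair i j p i ≡ j
matchPair-left i j p rewrite ==-refl i = refl

matchPair-right : {i j : Fin m} (p : Fin m → Fin m) → i ≢ j → matchPair i j p j ≡ i
matchPair-right {i = i} {j} p i≢j rewrite ≢⇒==-false (i≢j ∘ sym) | ==-refl j = refl

matchPair-other : {i j k : Fin m} (p : Fin m → Fin m) → k ≢ i → k ≢ j → matchPair i j p k ≡ p k
matchPair-other p k≢i k≢j rewrite ≢⇒==-false k≢i | ≢⇒==-false k≢j = refl

perfectOn-insert : {G : Graph m} {W : Fin m → Bool} {i j : Fin m} {p : Fin m → Fin m} →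
  W i ≡ true → W j ≡ true → Adj G i j ≡ true →
  PerfectOn G (remove (remove W i) j) p → PerfectOn G W (matchPair i j p)
perfectOn-insert {G = G} {W} {i} {j} {p} Wi Wj ij perfect k Wk = cases (k ≟ i) (k ≟ j)
  where
    q = matchPair i j p
    i≢j = adj⇒≢ G ij
    cases : Dec (k ≡ i) → Dec (k ≡ j) → W (q k) ≡ true × q (q k) ≡ k × Adj G k (q k) ≡ true
    cases (yes refl) _ rewrite matchPair-left k j p | matchPair-right p i≢j = Wj , refl , ij
    cases (no k≢i) (yes refl) rewrite matchPair-right p i≢j | matchPair-left i k p = Wi , refl , adj-sym G ij
    cases (no k≢i) (no k≢j)
      with W∘p , involutive , adjacent ← perfect k (remove-intro (remove W i) k≢j (remove-intro W k≢i Wk)) =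
      subst (λ z → W z ≡ true) (sym qk≡pk) (remove-⊆ W (remove-⊆ (remove W i) W∘p)) ,
      trans (cong q qk≡pk)
            (trans (matchPair-other p (remove-≢ W (remove-⊆ (remove W i) W∘p)) (remove-≢ (remove W i) W∘p))
                   involutive) ,
      subst (λ z → Adj G k z ≡ true) (sym qk≡pk) adjacent
      where qk≡pk = matchPair-other p k≢i k≢j

perfectOn-remove : {G : Graph m} {W : Fin m → Bool} {p : Fin m → Fin m} {i : Fin m} →
  PerfectOn G W p → W i ≡ true → PerfectOn G (remove (remove W i) (p i)) p
perfectOn-remove {G = G} {W} {p} {i} perfect Wi z W′z
  with W∘p , involutive , adjacent ← perfect z (remove-⊆ W (remove-⊆ (remove W i) W′z)) =
  remove-intro (remove W i) pz≢pi (remove-intro W pz≢i W∘p) , involutive , adjacent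
  where
    pz≢i : p z ≢ i
    pz≢i pz≡i = remove-≢ (remove W i) W′z (trans (sym involutive) (cong p pz≡i))
    pz≢pi : p z ≢ p i
    pz≢pi pz≡pi = remove-≢ W (remove-⊆ (remove W i) W′z)
      (trans (sym involutive) (trans (cong p pz≡pi) (proj₁ (proj₂ (perfect i Wi)))))

perfectOn-union : {G : Graph m} {W : Fin m → Bool} {p q : Fin m → Fin m} →
  PerfectOn G W p → PerfectOn G (not ∘ W) q → PerfectMatching G
perfectOn-union {G = G} {W} {p} {q} inside outside = record
  { partner = partner′ ; partner-involutive = involutive ; partner-adjacent = adjacent }
  where
    partner′ : Fin _ → Fin _
    partner′ k = if W k then p k else q k
    involutive : ∀ k → partner′ (partner′ k) ≡ k
    involutive k with W k in Wk
    ... | true rewrite proj₁ (inside k Wk) = proj₁ (proj₂ (inside k Wk))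
    ... | false with W (q k) | outside k (cong not Wk)
    ...   | false | _ , q-involutive , _ = q-involutive
    ...   | true | () , _
    adjacent : ∀ k → Adj G k (partner′ k) ≡ true
    adjacent k with W k in Wk
    ... | true = proj₂ (proj₂ (inside k Wk))
    ... | false = proj₂ (proj₂ (outside k (cong not Wk)))

perfectOn-all : {G : Graph m} {p : Fin m → Fin m} → PerfectOn G (λ _ → true) p → PerfectMatching G
perfectOn-all {p = p} perfect = record
  { partner = p
  ; partner-involutive = λ i → proj₁ (proj₂ (perfect i refl))
  ; partner-adjacent = λ i → proj₂ (proj₂ (perfect i refl))
  }

-- A matching with its endpoints indexed by Fin k ⊎ Fin k, which is easier to extend and truncate.
record Matching⊎ (G : Graph m) (k : ℕ) : Set where
  field
    ends : Fin k ⊎ Fin k → Fin m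
    ends-injective : Injective _≡_ _≡_ ends
    ends-adjacent : ∀ r → Adj G (ends (inj₁ r)) (ends (inj₂ r)) ≡ true
open Matching⊎

toMatching : {G : Graph m} {k : ℕ} → Matching⊎ G k → Matching G k
toMatching {k = k} M = record
  { u = ends M ∘ inj₁ ; v = ends M ∘ inj₂ ; isEdge = ends-adjacent M ; disjoint = disjoint }
  where
    η : ∀ x → [ ends M ∘ inj₁ , ends M ∘ inj₂ ] x ≡ ends M x
    η (inj₁ _) = refl
    η (inj₂ _) = refl
    disjoint : Injective _≡_ _≡_ ([ ends M ∘ inj₁ , ends M ∘ inj₂ ] ∘ splitAt k)
    disjoint {x} {y} eq = begin
      x                       ≡⟨ join-splitAt k k x ⟨
      join k k (splitAt k x)  ≡⟨ cong (join k k) (ends-injective M (trans (sym (η (splitAt k x))) (trans eq (η (splitAt k y))))) ⟩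
      join k k (splitAt k y)  ≡⟨ join-splitAt k k y ⟩
      y                       ∎
      where open ≡-Reasoning

matching⊎-empty : {G : Graph m} → Matching⊎ G 0
matching⊎-empty = record { ends = λ { (inj₁ ()) ; (inj₂ ()) } ; ends-injective = λ { {inj₁ ()} ; {inj₂ ()} } ; ends-adjacent = λ () }

matching⊎-truncate : {G : Graph m} {j k : ℕ} → Matching⊎ G k → j ≤ k → Matching⊎ G j
matching⊎-truncate {j = j} {k} M j≤k = record
  { ends = ends M ∘ shrink
  ; ends-injective = λ eq → injective _ _ (ends-injective M eq)
  ; ends-adjacent = λ r → ends-adjacent M (inject≤ r j≤k)
  }
  where
    shrink : Fin j ⊎ Fin j → Fin k ⊎ Fin k
    shrink = Sum.map (λ r → inject≤ r j≤k) (λ r → inject≤ r j≤k)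
    injective : ∀ x y → shrink x ≡ shrink y → x ≡ y
    injective (inj₁ r) (inj₁ s) eq = cong inj₁ (inject≤-injective j≤k j≤k r s (inj₁-injective eq))
    injective (inj₂ r) (inj₂ s) eq = cong inj₂ (inject≤-injective j≤k j≤k r s (inj₂-injective eq))
    injective (inj₁ _) (inj₂ _) ()
    injective (inj₂ _) (inj₁ _) ()

matching⊎-insert : {G : Graph m} {W : Fin m → Bool} {i j : Fin m} {k : ℕ} →
  W i ≡ true → W j ≡ true → Adj G i j ≡ true →
  (M : Matching⊎ G k) → (∀ x → remove (remove W i) j (ends M x) ≡ true) →
  Σ (Matching⊎ G (suc k)) (λ M′ → ∀ x → W (ends M′ x) ≡ true)
matching⊎-insert {G = G} {W} {i} {j} {k} Wi Wj ij M inside =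
  record { ends = ends′ ; ends-injective = injective _ _ ; ends-adjacent = adjacent } , inside′
  where
    ends′ : Fin (suc k) ⊎ Fin (suc k) → Fin _
    ends′ (inj₁ zero) = i
    ends′ (inj₂ zero) = j
    ends′ (inj₁ (suc r)) = ends M (inj₁ r)
    ends′ (inj₂ (suc r)) = ends M (inj₂ r)
    i≢j = adj⇒≢ G ij
    fresh : ∀ x → ends M x ≢ i × ends M x ≢ j
    fresh x = remove-≢ W (remove-⊆ (remove W i) (inside x)) , remove-≢ (remove W i) (inside x)
    injective : ∀ x y → ends′ x ≡ ends′ y → x ≡ y
    injective (inj₁ zero) (inj₁ zero) _ = refl
    injective (inj₂ zero) (inj₂ zero) _ = refl
    injective (inj₁ zero) (inj₂ zero) i≡j = contradiction i≡j i≢j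
    injective (inj₂ zero) (inj₁ zero) j≡i = contradiction (sym j≡i) i≢j
    injective (inj₁ zero) (inj₁ (suc s)) eq = contradiction (sym eq) (proj₁ (fresh (inj₁ s)))
    injective (inj₁ zero) (inj₂ (suc s)) eq = contradiction (sym eq) (proj₁ (fresh (inj₂ s)))
    injective (inj₂ zero) (inj₁ (suc s)) eq = contradiction (sym eq) (proj₂ (fresh (inj₁ s)))
    injective (inj₂ zero) (inj₂ (suc s)) eq = contradiction (sym eq) (proj₂ (fresh (inj₂ s)))
    injective (inj₁ (suc r)) (inj₁ zero) eq = contradiction eq (proj₁ (fresh (inj₁ r)))
    injective (inj₂ (suc r)) (inj₁ zero) eq = contradiction eq (proj₁ (fresh (inj₂ r)))
    injective (inj₁ (suc r)) (inj₂ zero) eq = contradiction eq (proj₂ (fresh (inj₁ r)))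
    injective (inj₂ (suc r)) (inj₂ zero) eq = contradiction eq (proj₂ (fresh (inj₂ r)))
    injective (inj₁ (suc r)) (inj₁ (suc s)) eq = cong (Sum.map suc suc) (ends-injective M eq)
    injective (inj₁ (suc r)) (inj₂ (suc s)) eq = cong (Sum.map suc suc) (ends-injective M eq)
    injective (inj₂ (suc r)) (inj₁ (suc s)) eq = cong (Sum.map suc suc) (ends-injective M eq)
    injective (inj₂ (suc r)) (inj₂ (suc s)) eq = cong (Sum.map suc suc) (ends-injective M eq)
    adjacent : ∀ r → Adj G (ends′ (inj₁ r)) (ends′ (inj₂ r)) ≡ true
    adjacent zero = ij
    adjacent (suc r) = ends-adjacent M r
    inside′ : ∀ x → W (ends′ x) ≡ true
    inside′ (inj₁ zero) = Wi
    inside′ (inj₂ zero) = Wj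
    inside′ (inj₁ (suc r)) = remove-⊆ W (remove-⊆ (remove W i) (inside (inj₁ r)))
    inside′ (inj₂ (suc r)) = remove-⊆ W (remove-⊆ (remove W i) (inside (inj₂ r)))

matching⊎-perfectOn : (G : Graph m) {p : Fin m → Fin m} (W : Fin m → Bool) → PerfectOn G W p →
  ∃[ k ] Σ (Matching⊎ G k) (λ M → ∀ x → W (ends M x) ≡ true) × count W ≡ k + k
matching⊎-perfectOn G {p} = measure-rec count Goal step
  where
    Goal : (Fin _ → Bool) → Set
    Goal W = PerfectOn G W p → ∃[ k ] Σ (Matching⊎ G k) (λ M → ∀ x → W (ends M x) ≡ true) × count W ≡ k + k
    step : ∀ W → (∀ W′ → count W′ < count W → Goal W′) → Goal W
    step W rec perfect with any? (λ i → W i Bool.≟ true)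
    ... | no empty = 0 , (matching⊎-empty , λ { (inj₁ ()) ; (inj₂ ()) }) , count-none (λ i → ¬-not (empty ∘ (i ,_)))
    ... | yes (i , Wi)
      with Wpi , _ , adjacent ← perfect i Wi
      with k , (M , inside) , count≡ ← rec (remove (remove W i) (p i)) (count-remove₂-< W Wi Wpi (adj⇒≢ G adjacent ∘ sym))
                                            (perfectOn-remove {G = G} perfect Wi)
      = suc k , matching⊎-insert Wi Wpi adjacent M inside , counted
      where
        counted : count W ≡ suc k + suc k
        counted = begin
          count W                                                          ≡⟨ count-remove₂ W (adj⇒≢ G adjacent ∘ sym) ⟩
          count (remove (remove W i) (p i)) + ⟦ W (p i) ⟧ + ⟦ W i ⟧
            ≡⟨ cong₂ (λ u v → count (remove (remove W i) (p i)) + ⟦ u ⟧ + ⟦ v ⟧) Wpi Wi ⟩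
          count (remove (remove W i) (p i)) + 1 + 1                        ≡⟨ cong (λ n → n + 1 + 1) count≡ ⟩
          k + k + 1 + 1                                                    ≡⟨ trans (+-comm _ 1) (cong suc (+-comm _ 1)) ⟩
          suc (suc (k + k))                                                ≡⟨ cong suc (+-suc k k) ⟨
          suc k + suc k                                                    ∎
          where open ≡-Reasoning

-- Classes of vertices outside a set S

classSize : (W S : Fin m → Bool) (ℓ : Fin m → Fin n) → Fin n → ℕ
classSize W S ℓ c = count (λ k → W k ∧ (not (S k) ∧ (ℓ k == c)))

oddClasses : (W S : Fin m → Bool) (ℓ : Fin m → Fin n) → ℕ
oddClasses W S ℓ = count (λ c → odd (classSize W S ℓ c))

-- The class sizes add up to the number of vertices outside S.
odd-oddClasses : (S : Fin m → Bool) (ℓ : Fin m → Fin m) → odd m ≡ false →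
  odd (oddClasses (λ _ → true) S ℓ) ≡ odd (count S)
odd-oddClasses {m} S ℓ m-even = begin
  odd (oddClasses (λ _ → true) S ℓ)         ≡⟨ odd-sum (classSize (λ _ → true) S ℓ) ⟨
  odd (sum (classSize (λ _ → true) S ℓ))    ≡⟨ cong odd sizes ⟩
  odd (count (not ∘ S))                     ≡⟨ complement ⟩
  odd (count S)                             ∎
  where
    open ≡-Reasoning
    sizes : sum (classSize (λ _ → true) S ℓ) ≡ count (not ∘ S)
    sizes = trans (∑-comm (λ c k → ⟦ not (S k) ∧ (ℓ k == c) ⟧)) (sum-cong-≗ (λ k → sum-indicator-== (ℓ k) (not (S k))))
    total : count S + count (not ∘ S) ≡ m
    total = trans (count-split (λ _ → true) S) count-all
    complement : odd (count (not ∘ S)) ≡ odd (count S)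
    complement = sym (xor≡false⇒≡ (trans (sym (odd-+ (count S) _)) (trans (cong odd total) m-even)))
      where
        xor≡false⇒≡ : ∀ {a b} → a xor b ≡ false → a ≡ b
        xor≡false⇒≡ {true} {true} _ = refl
        xor≡false⇒≡ {false} {false} _ = refl

module CliqueMatching {m} (G : Graph m) (S : Fin m → Bool) (ℓ : Fin m → Fin m)
  (clique : ∀ {i j} → S i ≡ false → S j ≡ false → ℓ i ≡ ℓ j → i ≢ j → Adj G i j ≡ true)
  (universal : ∀ {s i} → S s ≡ true → s ≢ i → Adj G s i ≡ true) where

  inClass : Fin m → Fin m → Bool
  inClass c k = not (S k) ∧ (ℓ k == c)

  inS : (Fin m → Bool) → ℕ
  inS W = count (λ k → W k ∧ S k)

  Balanced : (Fin m → Bool) → Set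
  Balanced W = oddClasses W S ℓ ≤ inS W × odd (oddClasses W S ℓ) ≡ odd (inS W)

  oddClasses-⊆S : {W : Fin m → Bool} → (∀ k → W k ≡ true → S k ≡ true) → oddClasses W S ℓ ≡ 0
  oddClasses-⊆S {W} W⊆S = count-none (λ c → cong odd (count-none (outside c)))
    where
      outside : ∀ c k → W k ∧ inClass c k ≡ false
      outside c k with W k in Wk
      ... | false = refl
      ... | true rewrite W⊆S k Wk = refl

  module _ {W : Fin m → Bool} {i j : Fin m} (Wi : W i ≡ true) (Wj : W j ≡ true) (j≢i : j ≢ i) where

    private
      W′ = remove (remove W i) j

      classSize-remove₂ : ∀ c → classSize W S ℓ c ≡ classSize W′ S ℓ c + ⟦ inClass c j ⟧ + ⟦ inClass c i ⟧
      classSize-remove₂ c = count-remove₂-∧ W (inClass c) Wi Wj j≢i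

      inS-remove₂ : inS W ≡ inS W′ + ⟦ S j ⟧ + ⟦ S i ⟧
      inS-remove₂ = count-remove₂-∧ W S Wi Wj j≢i

    balanced-sameClass : S i ≡ false → S j ≡ false → ℓ j ≡ ℓ i → Balanced W → Balanced W′
    balanced-sameClass Si Sj ℓj≡ℓi = subst₂ (λ o s → o ≤ s × odd o ≡ odd s) oddClasses-same inS-same
      where
        oddClasses-same : oddClasses W S ℓ ≡ oddClasses W′ S ℓ
        oddClasses-same = count-cong parity-same
          where
            parity-same : ∀ c → odd (classSize W S ℓ c) ≡ odd (classSize W′ S ℓ c)
            parity-same c = begin
              odd (classSize W S ℓ c)                                         ≡⟨ cong odd (classSize-remove₂ c) ⟩
              odd (classSize W′ S ℓ c + ⟦ inClass c j ⟧ + ⟦ inClass c i ⟧)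
                ≡⟨ cong (λ b → odd (classSize W′ S ℓ c + ⟦ b ⟧ + ⟦ inClass c i ⟧)) same ⟩
              odd (classSize W′ S ℓ c + ⟦ inClass c i ⟧ + ⟦ inClass c i ⟧)
                ≡⟨ odd-+-twice (classSize W′ S ℓ c) ⟦ inClass c i ⟧ ⟩
              odd (classSize W′ S ℓ c)                                        ∎
              where
                open ≡-Reasoning
                same : inClass c j ≡ inClass c i
                same rewrite Si | Sj | ℓj≡ℓi = refl
        inS-same : inS W ≡ inS W′
        inS-same rewrite inS-remove₂ | Si | Sj = trans (+-identityʳ _) (+-identityʳ _)

    balanced-lonely : S i ≡ true → S j ≡ false → classSize W S ℓ (ℓ j) ≡ 1 → Balanced W → Balanced W′
    balanced-lonely Si Sj lonely (odd≤inS , parity) =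
      ≤-pred (subst₂ _≤_ oddClasses-suc inS-suc odd≤inS) ,
      not-injective (subst₂ (λ o s → odd o ≡ odd s) oddClasses-suc inS-suc parity)
      where
        classSize-remove₂′ : ∀ c → classSize W S ℓ c ≡ classSize W′ S ℓ c + ⟦ ℓ j == c ⟧
        classSize-remove₂′ c rewrite classSize-remove₂ c | Si | Sj = +-identityʳ _
        oddClasses-suc : oddClasses W S ℓ ≡ suc (oddClasses W′ S ℓ)
        oddClasses-suc = count-flip (ℓ j) other (cong odd lonely) (cong odd emptied)
          where
            other : ∀ c → c ≢ ℓ j → odd (classSize W S ℓ c) ≡ odd (classSize W′ S ℓ c)
            other c c≢ℓj rewrite classSize-remove₂′ c | ≢⇒==-false (c≢ℓj ∘ sym) = cong odd (+-identityʳ (classSize W′ S ℓ c))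
            emptied : classSize W′ S ℓ (ℓ j) ≡ 0
            emptied = +-cancelʳ-≡ 1 _ 0 (trans (sym (trans (classSize-remove₂′ (ℓ j)) (cong (λ b → classSize W′ S ℓ (ℓ j) + ⟦ b ⟧)
                                                                                            (==-refl (ℓ j)))))
                                               lonely)
        inS-suc : inS W ≡ suc (inS W′)
        inS-suc rewrite inS-remove₂ | Si | Sj = trans (cong (_+ 1) (+-identityʳ _)) (+-comm _ 1)

    balanced-⊆S : S i ≡ true → S j ≡ true → (∀ k → W k ≡ true → S k ≡ true) → Balanced W → Balanced W′
    balanced-⊆S Si Sj W⊆S (_ , parity) rewrite oddClasses-⊆S W⊆S =
      subst (_≤ inS W′) (sym (oddClasses-⊆S W′⊆S)) z≤n ,
      trans (cong odd (oddClasses-⊆S W′⊆S)) (trans parity (trans (cong odd inS-remove₂′) (odd-+-twice (inS W′) 1)))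
      where
        W′⊆S : ∀ k → W′ k ≡ true → S k ≡ true
        W′⊆S k W′k = W⊆S k (remove-⊆ W (remove-⊆ (remove W i) W′k))
        inS-remove₂′ : inS W ≡ inS W′ + 1 + 1
        inS-remove₂′ rewrite inS-remove₂ | Si | Sj = refl

  Lonely : (Fin m → Bool) → Fin m → Set
  Lonely W i = ∀ k → W k ≡ true → S k ≡ false → ℓ k ≡ ℓ i → k ≡ i

  classSize-lonely : {W : Fin m → Bool} {i : Fin m} → W i ≡ true → S i ≡ false → Lonely W i →
    classSize W S ℓ (ℓ i) ≡ 1
  classSize-lonely {W} {i} Wi Si lonely = begin
    classSize W S ℓ (ℓ i)                                                      ≡⟨ count-remove _ i ⟩
    count (remove (λ k → W k ∧ inClass (ℓ i) k) i) + ⟦ W i ∧ inClass (ℓ i) i ⟧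
      ≡⟨ cong₂ (λ n b → n + ⟦ b ⟧) (count-none alone) (cong₂ (λ w s → w ∧ (not s ∧ (ℓ i == ℓ i))) Wi Si) ⟩
    ⟦ ℓ i == ℓ i ⟧                                                             ≡⟨ cong ⟦_⟧ (==-refl (ℓ i)) ⟩
    1                                                                          ∎
    where
      open ≡-Reasoning
      alone : ∀ k → remove (λ k → W k ∧ inClass (ℓ i) k) i k ≡ false
      alone k with k ≟ i | W k in Wk | S k in Sk | ℓ k ≟ ℓ i
      ... | yes _ | _ | _ | _ = refl
      ... | no k≢i | true | false | yes ℓk≡ℓi = contradiction (lonely k Wk Sk ℓk≡ℓi) k≢i
      ... | no _ | true | false | no _ = refl
      ... | no _ | true | true | _ = refl
      ... | no _ | false | _ | _ = refl

  -- Match two vertices of one class while possible, then each remaining vertex outside S with a vertex of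
  -- S, and finally the vertices of S among themselves.
  module Step (W : Fin m → Bool) (rec : ∀ W′ → count W′ < count W → Balanced W′ → ∃ (PerfectOn G W′))
              (balanced : Balanced W) where

    pairUp : ∀ {i j} → W i ≡ true → W j ≡ true → Adj G i j ≡ true → Balanced (remove (remove W i) j) → ∃ (PerfectOn G W)
    pairUp {i} {j} Wi Wj ij balanced′
      with p , perfect ← rec _ (count-remove₂-< W Wi Wj (adj⇒≢ G ij ∘ sym)) balanced′ =
      matchPair i j p , perfectOn-insert {G = G} {W = W} Wi Wj ij perfect

    matchLonely : ∀ {i} → W i ≡ true → S i ≡ false → Lonely W i → ∃ (PerfectOn G W)
    matchLonely {i} Wi Si lonely =
      pairUp Ws Wi (universal Ss s≢i) (balanced-lonely Ws Wi (s≢i ∘ sym) Ss Si (classSize-lonely Wi Si lonely) balanced)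
      where
        inS-pos : 0 < inS W
        inS-pos = ≤-trans (witness⇒count-pos (λ c → odd (classSize W S ℓ c)) (cong odd (classSize-lonely Wi Si lonely)))
                          (proj₁ balanced)
        witness = count-witness {P = λ k → W k ∧ S k} inS-pos
        s = proj₁ witness
        Ws = proj₁ (∧-true⁻ (proj₂ witness))
        Ss = proj₂ (∧-true⁻ (proj₂ witness))
        s≢i : s ≢ i
        s≢i s≡i = contradiction (trans (sym Ss) (trans (cong S s≡i) Si)) λ ()

    matchInS : (∀ k → W k ≡ true → S k ≡ true) → ∃ (PerfectOn G W)
    matchInS W⊆S with any? (λ i → W i Bool.≟ true)
    ... | no empty = (λ k → k) , λ k Wk → contradiction (k , Wk) empty
    ... | yes (s₁ , Ws₁) =
      pairUp Ws₁ Ws₂ (universal (W⊆S s₁ Ws₁) s₁≢s₂)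
        (balanced-⊆S Ws₁ Ws₂ (s₁≢s₂ ∘ sym) (W⊆S s₁ Ws₁) (W⊆S s₂ Ws₂) W⊆S balanced)
      where
        inS-split : inS W ≡ suc (count (remove (λ k → W k ∧ S k) s₁))
        inS-split = trans (count-remove _ s₁)
                          (trans (cong (λ b → count (remove (λ k → W k ∧ S k) s₁) + ⟦ b ⟧) (cong₂ _∧_ Ws₁ (W⊆S s₁ Ws₁)))
                                 (+-comm _ 1))
        rest-odd : odd (count (remove (λ k → W k ∧ S k) s₁)) ≡ true
        rest-odd = not-injective (trans (cong odd (sym inS-split))
                                        (trans (sym (proj₂ balanced)) (cong odd (oddClasses-⊆S W⊆S))))
        second = count-witness (odd⇒pos rest-odd)
        s₂ = proj₁ second
        Ws₂ = proj₁ (∧-true⁻ (remove-⊆ (λ k → W k ∧ S k) (proj₂ second)))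
        s₁≢s₂ : s₁ ≢ s₂
        s₁≢s₂ = remove-≢ (λ k → W k ∧ S k) (proj₂ second) ∘ sym

    result : ∃ (PerfectOn G W)
    result with any? (λ i → any? (λ j → (W i Bool.≟ true) ×-dec (S i Bool.≟ false) ×-dec (W j Bool.≟ true)
                                        ×-dec (S j Bool.≟ false) ×-dec (ℓ j ≟ ℓ i) ×-dec ¬? (j ≟ i)))
    ... | yes (i , j , Wi , Si , Wj , Sj , ℓj≡ℓi , j≢i) =
      pairUp Wi Wj (clique Si Sj (sym ℓj≡ℓi) (j≢i ∘ sym)) (balanced-sameClass Wi Wj j≢i Si Sj ℓj≡ℓi balanced)
    ... | no noPair with any? (λ i → (W i Bool.≟ true) ×-dec (S i Bool.≟ false))
    ...   | yes (i , Wi , Si) = matchLonely Wi Si lonely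
      where
        lonely : Lonely W i
        lonely k Wk Sk ℓk≡ℓi with k ≟ i
        ... | yes k≡i = k≡i
        ... | no k≢i = contradiction (i , k , Wi , Si , Wk , Sk , ℓk≡ℓi , k≢i) noPair
    ...   | no noOutside = matchInS W⊆S
      where
        W⊆S : ∀ k → W k ≡ true → S k ≡ true
        W⊆S k Wk with S k in Sk
        ... | true = refl
        ... | false = contradiction (k , Wk , Sk) noOutside

  perfectOn-balanced : ∀ W → Balanced W → ∃ (PerfectOn G W)
  perfectOn-balanced = measure-rec count (λ W → Balanced W → ∃ (PerfectOn G W)) Step.result

-- Adding an edge

IsPair : Fin m → Fin m → Fin m → Fin m → Set
IsPair a c i j = (i ≡ a × j ≡ c) ⊎ (i ≡ c × j ≡ a)

isPair? : (a c i j : Fin m) → Dec (IsPair a c i j)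
isPair? a c i j = ((i ≟ a) ×-dec (j ≟ c)) ⊎-dec ((i ≟ c) ×-dec (j ≟ a))

addEdge : (G : Graph m) (a c : Fin m) → a ≢ c → Graph m
addEdge G a c a≢c = record
  { Adj = λ i j → Adj G i j ∨ does (isPair? a c i j)
  ; sym = λ i j → cong₂ _∨_ (Graph.sym G i j) (isPair-sym i j)
  ; irrefl = λ i → cong₂ _∨_ (Graph.irrefl G i) (dec-false (isPair? a c i i) not-loop)
  }
  where
    swap : ∀ {i j} → IsPair a c i j → IsPair a c j i
    swap (inj₁ (i≡a , j≡c)) = inj₂ (j≡c , i≡a)
    swap (inj₂ (i≡c , j≡a)) = inj₁ (j≡a , i≡c)
    isPair-sym : ∀ i j → does (isPair? a c i j) ≡ does (isPair? a c j i)
    isPair-sym i j = agree (isPair? a c i j) (isPair? a c j i)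
      where
        agree : (p? : Dec (IsPair a c i j)) (q? : Dec (IsPair a c j i)) → does p? ≡ does q?
        agree (yes _) (yes _) = refl
        agree (no _) (no _) = refl
        agree (yes p) (no ¬q) = contradiction (swap p) ¬q
        agree (no ¬p) (yes q) = contradiction (swap q) ¬p
    not-loop : ∀ {i} → ¬ IsPair a c i i
    not-loop (inj₁ (i≡a , i≡c)) = a≢c (trans (sym i≡a) i≡c)
    not-loop (inj₂ (i≡c , i≡a)) = a≢c (trans (sym i≡a) i≡c)

module _ (G : Graph m) {a c : Fin m} (a≢c : a ≢ c) where

  addEdge-⊇ : ∀ {i j} → Adj G i j ≡ true → Adj (addEdge G a c a≢c) i j ≡ true
  addEdge-⊇ ij rewrite ij = refl

  addEdge-new : Adj (addEdge G a c a≢c) a c ≡ true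
  addEdge-new = trans (cong (Adj G a c ∨_) (dec-true (isPair? a c a c) (inj₁ (refl , refl)))) (∨-zeroʳ _)

  addEdge-⊆ : ∀ {i j} → Adj (addEdge G a c a≢c) i j ≡ true → Adj G i j ≡ true ⊎ IsPair a c i j
  addEdge-⊆ {i} {j} = cases (Adj G i j) (isPair? a c i j)
    where
      cases : ∀ b (p? : Dec (IsPair a c i j)) → b ∨ does p? ≡ true → b ≡ true ⊎ IsPair a c i j
      cases true _ _ = inj₁ refl
      cases false (yes pair) _ = inj₂ pair

  addEdge-⊆-away : ∀ {i j} → Adj (addEdge G a c a≢c) i j ≡ true → i ≢ a → i ≢ c → Adj G i j ≡ true
  addEdge-⊆-away ij i≢a i≢c with addEdge-⊆ ij
  ... | inj₁ old = old
  ... | inj₂ (inj₁ (i≡a , _)) = contradiction i≡a i≢a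
  ... | inj₂ (inj₂ (i≡c , _)) = contradiction i≡c i≢c

nonEdges : Graph m → ℕ
nonEdges G = sum (λ i → count (λ j → not (Adj G i j)))

nonEdges-addEdge : (G : Graph m) {a c : Fin m} (a≢c : a ≢ c) → Adj G a c ≡ false → nonEdges (addEdge G a c a≢c) < nonEdges G
nonEdges-addEdge G {a} {c} a≢c ac =
  sum-mono-< (λ i → sum-mono-≤ (fewer i)) a (sum-mono-< (fewer a) c gained)
  where
    fewer : ∀ i j → ⟦ not (Adj (addEdge G a c a≢c) i j) ⟧ ≤ ⟦ not (Adj G i j) ⟧
    fewer i j = ∨-fewer (Adj G i j) (does (isPair? a c i j))
      where
        ∨-fewer : ∀ u v → ⟦ not (u ∨ v) ⟧ ≤ ⟦ not u ⟧
        ∨-fewer true _ = ≤-refl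
        ∨-fewer false true = z≤n
        ∨-fewer false false = ≤-refl
    gained : ⟦ not (Adj (addEdge G a c a≢c) a c) ⟧ < ⟦ not (Adj G a c) ⟧
    gained rewrite addEdge-new G a≢c | ac = s≤s z≤n

-- The walk b, d, M₁ d, M₂ (M₁ d), … alternates between
-- M₂ and M₁ until it meets a, b or c.  If it returns to b, M₁ on the walk and M₂ off it form a perfect
-- matching of G; if it reaches x ∈ {a, c}, take M₁ on the walk strictly between b and x, the edge xb,
-- and M₂ elsewhere.
module AlternatingWalk {m} (G : Graph m) {a b c d : Fin m} (a≢c : a ≢ c) (b≢d : b ≢ d)
  (ab : Adj G a b ≡ true) (bc : Adj G b c ≡ true) (bd : Adj G b d ≡ false)
  (M₁ : PerfectMatching (addEdge G a c a≢c)) (M₂ : PerfectMatching (addEdge G b d b≢d))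
  (M₁a : partner M₁ a ≡ c) (M₂b : partner M₂ b ≡ d) where

  step : Bool → Fin m → Fin m
  step true = partner M₁
  step false = partner M₂

  step-involutive : ∀ π z → step π (step π z) ≡ z
  step-involutive true = partner-involutive M₁
  step-involutive false = partner-involutive M₂

  step-≢ : ∀ π z → step π z ≢ z
  step-≢ true z = adj⇒≢ (addEdge G a c a≢c) (partner-adjacent M₁ z) ∘ sym
  step-≢ false z = adj⇒≢ (addEdge G b d b≢d) (partner-adjacent M₂ z) ∘ sym

  step-adjacent₁ : ∀ {z} → z ≢ a → z ≢ c → Adj G z (step true z) ≡ true
  step-adjacent₁ = addEdge-⊆-away G a≢c (partner-adjacent M₁ _)

  step-adjacent₂ : ∀ {z} → z ≢ b → z ≢ d → Adj G z (step false z) ≡ true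
  step-adjacent₂ = addEdge-⊆-away G b≢d (partner-adjacent M₂ _)

  walk : ℕ → Fin m
  walk zero = b
  walk (suc k) = step (odd k) (walk k)

  walk-back : ∀ k → step (odd k) (walk (suc k)) ≡ walk k
  walk-back k = step-involutive (odd k) (walk k)

  step-walk : ∀ π k → (step π (walk (suc k)) ≡ walk (suc (suc k)) × odd (suc k) ≡ π)
                     ⊎ (step π (walk (suc k)) ≡ walk k × odd k ≡ π)
  step-walk π k with odd k Bool.≟ π
  ... | yes refl = inj₂ (walk-back k , refl)
  ... | no odd≢π rewrite sym (¬-not (odd≢π ∘ sym)) = inj₁ (refl , refl)

  -- Each step is an involution, so the walk can revisit a vertex only after returning to b.
  walk-injective : ∀ {i j} → i < j → (∀ k → k < j → walk (suc k) ≢ b) → walk i ≢ walk j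
  walk-injective {zero} {suc j} _ avoid b≡walk = avoid j ≤-refl (sym b≡walk)
  walk-injective {suc i} {suc j} (s≤s i<j) avoid eq with odd i Bool.≟ odd j
  ... | yes same = walk-injective i<j (λ k k<j → avoid k (m<n⇒m<1+n k<j))
                     (trans (sym (walk-back i)) (trans (cong₂ step same eq) (walk-back j)))
  ... | no differ with <-cmp (suc (suc i)) j
  ...   | tri< i+2<j _ _ = walk-injective i+2<j (λ k k<j → avoid k (m<n⇒m<1+n k<j))
                             (trans (cong (step (odd (suc i))) eq)
                                    (trans (cong (λ π → step π (walk (suc j))) (sym (¬-not (differ ∘ sym)))) (walk-back j)))
  ...   | tri≈ _ refl _ = differ (sym (not-involutive (odd i)))
  ...   | tri> _ _ j<i+2 with ≤-antisym i<j (≤-pred j<i+2)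
  ...     | refl = step-≢ (odd (suc i)) (walk (suc i)) (sym eq)

  End : Fin m → Set
  End z = z ≡ a ⊎ z ≡ b ⊎ z ≡ c

  firstEnd : ∃[ t ] End (walk (suc t)) × (∀ k → k < t → ¬ End (walk (suc k)))
  firstEnd with search (λ k → (walk (suc k) ≟ a) ⊎-dec (walk (suc k) ≟ b) ⊎-dec (walk (suc k) ≟ c)) m
  ... | inj₁ (t , _ , end , before) = t , end , before
  ... | inj₂ none with i , j , i<j , eq ← pigeonhole (n<1+n m) (walk ∘ toℕ) =
    ⊥-elim (walk-injective i<j (λ k k<j walk≡b → none k (≤-trans (<⇒≤ k<j) (≤-pred (toℕ<n j))) (inj₂ (inj₁ walk≡b))) eq)

  t : ℕ
  t = proj₁ firstEnd

  b≢a : b ≢ a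
  b≢a = adj⇒≢ G ab ∘ sym

  b≢c : b ≢ c
  b≢c = adj⇒≢ G bc

  walk-≢b : ∀ {k} → k < t → walk (suc k) ≢ b
  walk-≢b {k} k<t = proj₂ (proj₂ firstEnd) k k<t ∘ inj₂ ∘ inj₁

  walk-≢ac : ∀ {k} → k ≤ t → walk k ≢ a × walk k ≢ c
  walk-≢ac {zero} _ = b≢a , b≢c
  walk-≢ac {suc k} k<t = proj₂ (proj₂ firstEnd) k k<t ∘ inj₁ , proj₂ (proj₂ firstEnd) k k<t ∘ inj₂ ∘ inj₂

  visited : ℕ → Fin m → Bool
  visited zero z = z == walk zero
  visited (suc n) z = visited n z ∨ (z == walk (suc n))

  visited-walk : ∀ {k} n → k ≤ n → visited n (walk k) ≡ true
  visited-walk zero z≤n = ==-refl b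
  visited-walk {k} (suc n) k≤1+n with m≤n⇒m<n∨m≡n k≤1+n
  ... | inj₁ k<1+n rewrite visited-walk n (≤-pred k<1+n) = refl
  ... | inj₂ refl rewrite ==-refl (walk (suc n)) = ∨-zeroʳ _

  visited⁻ : ∀ n {z} → visited n z ≡ true → ∃[ k ] k ≤ n × walk k ≡ z
  visited⁻ zero eq = 0 , z≤n , sym (==⇒≡ eq)
  visited⁻ (suc n) {z} = cases (visited n z) refl (z ≟ walk (suc n))
    where
      cases : ∀ v → visited n z ≡ v → (d? : Dec (z ≡ walk (suc n))) → v ∨ does d? ≡ true → ∃[ k ] k ≤ suc n × walk k ≡ z
      cases true eq _ _ with k , k≤n , walk≡z ← visited⁻ n eq = k , m≤n⇒m≤1+n k≤n , walk≡z
      cases false _ (yes z≡walk) _ = suc n , ≤-refl , sym z≡walk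

  perfectOn-step : ∀ π {W : Fin m → Bool} → (∀ z → W z ≡ true → W (step π z) ≡ true) →
    (∀ z → W z ≡ true → Adj G z (step π z) ≡ true) → PerfectOn G W (step π)
  perfectOn-step π closed adjacent z Wz = closed z Wz , step-involutive π z , adjacent z Wz

  complement-closed : ∀ π {W : Fin m → Bool} → (∀ z → W z ≡ true → W (step π z) ≡ true) →
    ∀ z → not (W z) ≡ true → not (W (step π z)) ≡ true
  complement-closed π {W} closed z notWz with W (step π z) in Wπz
  ... | false = refl
  ... | true = contradiction (trans (sym (subst (λ y → W y ≡ true) (step-involutive π z) (closed _ Wπz))) (not-true⁻ notWz)) λ ()

  unvisited : ∀ n {z k} → not (visited n z) ≡ true → k ≤ n → z ≢ walk k
  unvisited n nvz k≤n refl with () ← trans (cong not (sym (visited-walk n k≤n))) nvz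

  outside-adjacent : ∀ n → 1 ≤ n → ∀ z → not (visited n z) ≡ true → Adj G z (step false z) ≡ true
  outside-adjacent n 1≤n z nvz = step-adjacent₂ (unvisited n nvz z≤n) (λ z≡d → unvisited n nvz 1≤n (trans z≡d (sym M₂b)))

  module ReturnToB (x≡b : walk (suc t) ≡ b) where

    t-odd : odd t ≡ true
    t-odd with odd t Bool.≟ true
    ... | yes t-odd = t-odd
    ... | no t-not-odd = ⊥-elim (cases t refl)
      where
        t-even = ¬-not t-not-odd
        walk₁≡walkₜ : walk 1 ≡ walk t
        walk₁≡walkₜ = trans (cong (step false) (sym x≡b))
                            (trans (cong (λ π → step π (walk (suc t))) (sym t-even)) (walk-back t))
        cases : ∀ n → n ≡ t → ⊥
        cases zero 0≡t = b≢d (sym (trans (sym M₂b) (trans (cong (walk ∘ suc) 0≡t) x≡b)))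
        cases (suc zero) 1≡t with () ← trans (cong odd 1≡t) t-even
        cases (suc (suc n)) 2+n≡t =
          walk-injective (subst (2 ≤_) 2+n≡t (s≤s (s≤s z≤n))) (λ k → walk-≢b) walk₁≡walkₜ


    step₁-b : step true b ≡ walk t
    step₁-b = trans (cong (step true) (sym x≡b)) (trans (cong (λ π → step π (walk (suc t))) (sym t-odd)) (walk-back t))

    visited-closed : ∀ π z → visited t z ≡ true → visited t (step π z) ≡ true
    visited-closed π z vz with k , k≤t , refl ← visited⁻ t {z} vz = neighbour π k k≤t
      where
        neighbour : ∀ π k → k ≤ t → visited t (step π (walk k)) ≡ true
        neighbour false zero _ = visited-walk {1} t (odd⇒pos t-odd)
        neighbour true zero _ = subst (λ y → visited t y ≡ true) (sym step₁-b) (visited-walk t ≤-refl)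
        neighbour π (suc k) k<t with step-walk π k
        ... | inj₂ (backward , _) = subst (λ y → visited t y ≡ true) (sym backward) (visited-walk t (≤-trans (n≤1+n k) k<t))
        ... | inj₁ (forward , _) with m≤n⇒m<n∨m≡n k<t
        ...   | inj₁ 1+k<t = subst (λ y → visited t y ≡ true) (sym forward) (visited-walk t 1+k<t)
        ...   | inj₂ 1+k≡t = subst (λ y → visited t y ≡ true) (sym (trans forward (trans (cong (walk ∘ suc) 1+k≡t) x≡b)))
                                   (visited-walk t z≤n)

    perfectMatching : PerfectMatching G
    perfectMatching = perfectOn-union {W = visited t}
      (perfectOn-step true (visited-closed true) inside)
      (perfectOn-step false (complement-closed false (visited-closed false)) (outside-adjacent t (odd⇒pos t-odd)))
      where
        inside : ∀ z → visited t z ≡ true → Adj G z (step true z) ≡ true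
        inside z vz with k , k≤t , refl ← visited⁻ t {z} vz = step-adjacent₁ (proj₁ (walk-≢ac k≤t)) (proj₂ (walk-≢ac k≤t))

  module ReachAC (x-ac : walk (suc t) ≡ a ⊎ walk (suc t) ≡ c) where

    x : Fin m
    x = walk (suc t)

    x-unvisited : visited t x ≡ false
    x-unvisited with visited t x in vx
    ... | false = refl
    ... | true with k , k≤t , walk≡x ← visited⁻ t vx = contradiction x-ac ac-free
      where
        ac-free : ¬ (x ≡ a ⊎ x ≡ c)
        ac-free (inj₁ x≡a) = proj₁ (walk-≢ac k≤t) (trans walk≡x x≡a)
        ac-free (inj₂ x≡c) = proj₂ (walk-≢ac k≤t) (trans walk≡x x≡c)

    t-even : odd t ≡ false
    t-even with odd t Bool.≟ false
    ... | yes t-even = t-even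
    ... | no t-not-even = ⊥-elim (ac-free x-ac)
      where
        walkₜ≡ : walk t ≡ step true x
        walkₜ≡ = trans (sym (walk-back t)) (cong (λ π → step π x) (¬-not t-not-even))
        ac-free : ¬ (x ≡ a ⊎ x ≡ c)
        ac-free (inj₁ x≡a) = proj₂ (walk-≢ac ≤-refl) (trans walkₜ≡ (trans (cong (step true) x≡a) M₁a))
        ac-free (inj₂ x≡c) = proj₁ (walk-≢ac ≤-refl)
          (trans walkₜ≡ (trans (cong (step true) x≡c) (trans (cong (partner M₁) (sym M₁a)) (partner-involutive M₁ a))))

    xb : Adj G x b ≡ true
    xb = adjacent x-ac
      where
        adjacent : x ≡ a ⊎ x ≡ c → Adj G x b ≡ true
        adjacent (inj₁ x≡a) = subst (λ y → Adj G y b ≡ true) (sym x≡a) ab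
        adjacent (inj₂ x≡c) = subst (λ y → Adj G y b ≡ true) (sym x≡c) (adj-sym G bc)

    W₁ : Fin m → Bool
    W₁ = remove (visited t) b

    W₁-walk : ∀ {k} → k < t → W₁ (walk (suc k)) ≡ true
    W₁-walk k<t = remove-intro (visited t) (walk-≢b k<t) (visited-walk t k<t)

    W₁-closed : ∀ z → W₁ z ≡ true → W₁ (step true z) ≡ true
    W₁-closed z W₁z with k , k≤t , refl ← visited⁻ t {z} (remove-⊆ (visited t) W₁z) =
      neighbour k k≤t (remove-≢ (visited t) W₁z)
      where
        earlier : ∀ k → odd k ≡ true → k ≤ t → W₁ (walk k) ≡ true
        earlier (suc k) _ k<t = W₁-walk k<t
        neighbour : ∀ k → k ≤ t → walk k ≢ b → W₁ (step true (walk k)) ≡ true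
        neighbour zero _ b≢b = contradiction refl b≢b
        neighbour (suc k) k<t _ with step-walk true k
        ... | inj₂ (backward , odd-k) =
          subst (λ y → W₁ y ≡ true) (sym backward) (earlier k odd-k (≤-trans (n≤1+n k) k<t))
        ... | inj₁ (forward , odd-1+k) = subst (λ y → W₁ y ≡ true) (sym forward) (W₁-walk (≤∧≢⇒< k<t 1+k≢t))
          where
            1+k≢t : suc k ≢ t
            1+k≢t 1+k≡t with () ← trans (sym odd-1+k) (trans (cong odd 1+k≡t) t-even)

    visited-closed : ∀ z → visited (suc t) z ≡ true → visited (suc t) (step false z) ≡ true
    visited-closed z vz with k , k≤1+t , refl ← visited⁻ (suc t) {z} vz = neighbour k k≤1+t
      where
        neighbour : ∀ k → k ≤ suc t → visited (suc t) (step false (walk k)) ≡ true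
        neighbour zero _ = visited-walk {1} (suc t) (s≤s z≤n)
        neighbour (suc k) k<1+t with step-walk false k
        ... | inj₂ (backward , _) =
          subst (λ y → visited (suc t) y ≡ true) (sym backward) (visited-walk (suc t) (≤-trans (n≤1+n k) k<1+t))
        ... | inj₁ (forward , odd-1+k) =
          subst (λ y → visited (suc t) y ≡ true) (sym forward) (visited-walk (suc t) (s≤s (≤∧≢⇒< (≤-pred k<1+t) k≢t)))
          where
            k≢t : k ≢ t
            k≢t k≡t with () ← trans (sym odd-1+k) (trans (cong (odd ∘ suc) k≡t) (cong not t-even))

    outside≡ : ∀ z → not (visited (suc t) z) ≡ remove (remove (not ∘ W₁) x) b z
    outside≡ z with z ≟ b
    ... | yes refl rewrite visited-walk {0} t z≤n = refl
    ... | no _ with visited t z | z == x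
    ...   | true | true = refl
    ...   | true | false = refl
    ...   | false | true = refl
    ...   | false | false = refl

    perfectMatching : PerfectMatching G
    perfectMatching = perfectOn-union {G = G} {W = W₁}
      (perfectOn-step true W₁-closed inside)
      (perfectOn-insert {G = G} {W = not ∘ W₁} x-outside b-outside xb
        (perfectOn-cong {G = G} outside≡
          (perfectOn-step false (complement-closed false visited-closed) (outside-adjacent (suc t) (s≤s z≤n)))))
      where
        inside : ∀ z → W₁ z ≡ true → Adj G z (step true z) ≡ true
        inside z W₁z with k , k≤t , refl ← visited⁻ t {z} (remove-⊆ (visited t) W₁z) =
          step-adjacent₁ (proj₁ (walk-≢ac k≤t)) (proj₂ (walk-≢ac k≤t))
        x-outside : not (W₁ x) ≡ true
        x-outside rewrite x-unvisited | ∧-zeroʳ (not (x == b)) = refl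
        b-outside : not (W₁ b) ≡ true
        b-outside rewrite ==-refl b = refl

  perfectMatching : PerfectMatching G
  perfectMatching with proj₁ (proj₂ firstEnd)
  ... | inj₁ x≡a = ReachAC.perfectMatching (inj₁ x≡a)
  ... | inj₂ (inj₁ x≡b) = ReturnToB.perfectMatching x≡b
  ... | inj₂ (inj₂ x≡c) = ReachAC.perfectMatching (inj₂ x≡c)

-- Tutte's theorem

-- Adjacent vertices outside S share a label, so each class of label is a union of components of G − S.
record TutteObstruction (G : Graph m) : Set where
  field
    S : Fin m → Bool
    label : Fin m → Fin m
    label-adjacent : ∀ {i j} → S i ≡ false → S j ≡ false → Adj G i j ≡ true → label i ≡ label j
    many-odd : 2 + count S ≤ oddClasses (λ _ → true) S label

module _ (G : Graph m) {a c : Fin m} (a≢c : a ≢ c) where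

  obstruction-addEdge : TutteObstruction (addEdge G a c a≢c) → TutteObstruction G
  obstruction-addEdge obstruction = record
    { S = S ; label = label ; many-odd = many-odd
    ; label-adjacent = λ Si Sj ij → label-adjacent Si Sj (addEdge-⊇ G a≢c ij)
    }
    where open TutteObstruction obstruction

  perfectMatching-addEdge : (M : PerfectMatching (addEdge G a c a≢c)) → partner M a ≢ c → PerfectMatching G
  perfectMatching-addEdge M Ma≢c = record
    { partner = partner M ; partner-involutive = partner-involutive M ; partner-adjacent = adjacent }
    where
      adjacent : ∀ i → Adj G i (partner M i) ≡ true
      adjacent i with addEdge-⊆ G a≢c (partner-adjacent M i)
      ... | inj₁ old = old
      ... | inj₂ (inj₁ (refl , Ma≡c)) = contradiction Ma≡c Ma≢c
      ... | inj₂ (inj₂ (refl , Mc≡a)) = contradiction (trans (cong (partner M) (sym Mc≡a)) (partner-involutive M c)) Ma≢c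

universal : Graph m → Fin m → Bool
universal G i = does (all? (λ j → (i ≟ j) ⊎-dec (Adj G i j Bool.≟ true)))

universal-adj : (G : Graph m) {s i : Fin m} → universal G s ≡ true → s ≢ i → Adj G s i ≡ true
universal-adj G {s} {i} Us s≢i with dec-true⁻ (all? (λ j → (s ≟ j) ⊎-dec (Adj G s j Bool.≟ true))) Us i
... | inj₁ s≡i = contradiction s≡i s≢i
... | inj₂ si = si

universal-false : (G : Graph m) {i : Fin m} → universal G i ≡ false → ∃[ j ] i ≢ j × Adj G i j ≡ false
universal-false G {i} Ui
  with j , ¬adjacent ← ¬∀⟶∃¬ _ _ (λ j → (i ≟ j) ⊎-dec (Adj G i j Bool.≟ true))
                                  (dec-false⁻ (all? (λ j → (i ≟ j) ⊎-dec (Adj G i j Bool.≟ true))) Ui) =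
  j , ¬adjacent ∘ inj₁ , ¬-not (¬adjacent ∘ inj₂)

Wedge : Graph m → Fin m → Fin m → Fin m → Set
Wedge G a b c = universal G a ≡ false × universal G b ≡ false × universal G c ≡ false
              × Adj G a b ≡ true × Adj G b c ≡ true × Adj G a c ≡ false × a ≢ c

wedge? : (G : Graph m) (a b c : Fin m) → Dec (Wedge G a b c)
wedge? G a b c = (universal G a Bool.≟ false) ×-dec (universal G b Bool.≟ false) ×-dec (universal G c Bool.≟ false)
               ×-dec (Adj G a b Bool.≟ true) ×-dec (Adj G b c Bool.≟ true) ×-dec (Adj G a c Bool.≟ false) ×-dec ¬? (a ≟ c)

module NoWedge {m} (G : Graph m) (no-wedge : ∀ a b c → ¬ Wedge G a b c) where

  S : Fin m → Bool
  S = universal G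

  SameClique : Fin m → Fin m → Set
  SameClique i j = i ≡ j ⊎ (S i ≡ false × S j ≡ false × Adj G i j ≡ true)

  sameClique? : ∀ i j → Dec (SameClique i j)
  sameClique? i j = (i ≟ j) ⊎-dec ((S i Bool.≟ false) ×-dec (S j Bool.≟ false) ×-dec (Adj G i j Bool.≟ true))

  sameClique-sym : ∀ {i j} → SameClique i j → SameClique j i
  sameClique-sym (inj₁ refl) = inj₁ refl
  sameClique-sym (inj₂ (Si , Sj , ij)) = inj₂ (Sj , Si , adj-sym G ij)

  sameClique-trans : ∀ {i j k} → SameClique i j → SameClique j k → SameClique i k
  sameClique-trans (inj₁ refl) jk = jk
  sameClique-trans ij (inj₁ refl) = ij
  sameClique-trans {i} {j} {k} (inj₂ (Si , Sj , ij)) (inj₂ (_ , Sk , jk)) with i ≟ k | Adj G i k in ik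
  ... | yes i≡k | _ = inj₁ i≡k
  ... | no _ | true = inj₂ (Si , Sk , refl)
  ... | no i≢k | false = contradiction (Si , Sj , Sk , ij , jk , ik , i≢k) (no-wedge i j k)

  label : Fin m → Fin m
  label i = fromMaybe i (firstTrue (does ∘ sameClique? i))

  label-sameClique : ∀ i → SameClique i (label i)
  label-sameClique i with j , first≡j ← firstTrue-complete (does ∘ sameClique? i) (dec-true (sameClique? i i) (inj₁ refl))
    rewrite first≡j = dec-true⁻ (sameClique? i j) (firstTrue-sound (does ∘ sameClique? i) first≡j)

  sameClique-agree : ∀ {i j} → SameClique i j → ∀ k → does (sameClique? i k) ≡ does (sameClique? j k)
  sameClique-agree {i} {j} ij k = agree (sameClique? i k) (sameClique? j k)
    where
      agree : (ik? : Dec (SameClique i k)) (jk? : Dec (SameClique j k)) → does ik? ≡ does jk?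
      agree (yes _) (yes _) = refl
      agree (no _) (no _) = refl
      agree (yes ik) (no ¬jk) = contradiction (sameClique-trans (sameClique-sym ij) ik) ¬jk
      agree (no ¬ik) (yes jk) = contradiction (sameClique-trans ij jk) ¬ik

  label-cong : ∀ {i j} → SameClique i j → label i ≡ label j
  label-cong {i} {j} ij
    with k , first≡k ← firstTrue-complete (does ∘ sameClique? i) (dec-true (sameClique? i i) (inj₁ refl))
    rewrite first≡k | sym (firstTrue-cong (sameClique-agree ij)) | first≡k = refl

  clique : ∀ {i j} → S i ≡ false → S j ≡ false → label i ≡ label j → i ≢ j → Adj G i j ≡ true
  clique {i} {j} _ _ same i≢j
    with sameClique-trans (label-sameClique i) (sameClique-sym (subst (SameClique j) (sym same) (label-sameClique j)))
  ... | inj₁ i≡j = contradiction i≡j i≢j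
  ... | inj₂ (_ , _ , ij) = ij

  perfectMatching-or-obstruction : odd m ≡ false → PerfectMatching G ⊎ TutteObstruction G
  perfectMatching-or-obstruction m-even = decide (≤-<-connex (oddClasses (λ _ → true) S label) (count S))
    where
      open CliqueMatching G S label clique (universal-adj G)
      parity = odd-oddClasses S label m-even
      decide : oddClasses (λ _ → true) S label ≤ count S ⊎ count S < oddClasses (λ _ → true) S label →
        PerfectMatching G ⊎ TutteObstruction G
      decide (inj₁ few-odd) = inj₁ (perfectOn-all (proj₂ (perfectOn-balanced (λ _ → true) (few-odd , parity))))
      decide (inj₂ many-odd) = inj₂ (record
        { S = S ; label = label
        ; label-adjacent = λ Si Sj ij → label-cong (inj₂ (Si , Sj , ij))
        ; many-odd = same-parity-gap many-odd (sym parity)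
        })

-- Lovász's proof: add a missing edge ac or bd of a wedge a–b–c (d a non-neighbour of b); obstructions
-- persist when edges are removed, and perfect matchings of both supergraphs combine along an
-- alternating walk into one avoiding the new edges.  Without wedges, G minus its universal vertices
-- is a disjoint union of cliques.
tutte : odd m ≡ false → (G : Graph m) → PerfectMatching G ⊎ TutteObstruction G
tutte m-even = measure-rec nonEdges (λ G → PerfectMatching G ⊎ TutteObstruction G) step
  where
  step : ∀ G → (∀ H → nonEdges H < nonEdges G → PerfectMatching H ⊎ TutteObstruction H) →
    PerfectMatching G ⊎ TutteObstruction G
  step G rec with any? (λ a → any? (λ b → any? (λ c → wedge? G a b c)))
  ... | no none = NoWedge.perfectMatching-or-obstruction G (λ a b c w → none (a , b , c , w)) m-even
  ... | yes (a , b , c , _ , Ub , _ , ab , bc , ac , a≢c)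
    with d , b≢d , bd ← universal-false G Ub
    with rec (addEdge G a c a≢c) (nonEdges-addEdge G a≢c ac) | rec (addEdge G b d b≢d) (nonEdges-addEdge G b≢d bd)
  ... | inj₂ obstruction | _ = inj₂ (obstruction-addEdge G a≢c obstruction)
  ... | inj₁ _ | inj₂ obstruction = inj₂ (obstruction-addEdge G b≢d obstruction)
  ... | inj₁ M₁ | inj₁ M₂ with partner M₁ a ≟ c | partner M₂ b ≟ d
  ...   | no M₁a≢c | _ = inj₁ (perfectMatching-addEdge G a≢c M₁ M₁a≢c)
  ...   | yes _ | no M₂b≢d = inj₁ (perfectMatching-addEdge G b≢d M₂ M₂b≢d)
  ...   | yes M₁a | yes M₂b = inj₁ (AlternatingWalk.perfectMatching G a≢c b≢d ab bc bd M₁ M₂ M₁a M₂b)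

-- Adding universal vertices

joinAdj : (Fin N → Fin N → Bool) → Fin N ⊎ Fin j → Fin N ⊎ Fin j → Bool
joinAdj A (inj₁ u) (inj₁ v) = A u v
joinAdj A (inj₂ w) (inj₂ w′) = not (w == w′)
joinAdj A (inj₁ _) (inj₂ _) = true
joinAdj A (inj₂ _) (inj₁ _) = true

addUniversal : Graph N → (j : ℕ) → Graph (N + j)
addUniversal {N} G j = record
  { Adj = λ x y → joinAdj (Adj G) (splitAt N x) (splitAt N y)
  ; sym = λ x y → symmetric (splitAt N x) (splitAt N y)
  ; irrefl = λ x → irreflexive (splitAt N x)
  }
  where
    symmetric : ∀ x y → joinAdj (Adj G) x y ≡ joinAdj (Adj G) y x
    symmetric (inj₁ u) (inj₁ v) = Graph.sym G u v
    symmetric (inj₂ w) (inj₂ w′) with w ≟ w′ | w′ ≟ w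
    ... | yes _ | yes _ = refl
    ... | no _ | no _ = refl
    ... | yes w≡w′ | no w′≢w = contradiction (sym w≡w′) w′≢w
    ... | no w≢w′ | yes w′≡w = contradiction (sym w′≡w) w≢w′
    symmetric (inj₁ _) (inj₂ _) = refl
    symmetric (inj₂ _) (inj₁ _) = refl
    irreflexive : ∀ x → joinAdj (Adj G) x x ≡ false
    irreflexive (inj₁ u) = Graph.irrefl G u
    irreflexive (inj₂ w) = cong not (==-refl w)

isOld : Fin (N + j) → Bool
isOld {N} x = [ const true , const false ] (splitAt N x)

count-isOld : count (isOld {N} {j}) ≡ N
count-isOld {N} {j} = begin
  count (isOld {N} {j})                                                   ≡⟨ sum-++ {N} {j} (λ x → ⟦ isOld {N} {j} x ⟧) ⟩
  count (isOld {N} {j} ∘ (_↑ˡ j)) + count (isOld {N} {j} ∘ (N ↑ʳ_))      ≡⟨ cong₂ _+_ (count-cong old) (count-none new) ⟩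
  count {N} (λ _ → true) + 0                                              ≡⟨ cong (_+ 0) count-all ⟩
  N + 0                                                                   ≡⟨ +-identityʳ N ⟩
  N                                                                       ∎
  where
    open ≡-Reasoning
    old : ∀ u → isOld {N} {j} (u ↑ˡ j) ≡ true
    old u rewrite splitAt-↑ˡ N u j = refl
    new : ∀ w → isOld {N} {j} (N ↑ʳ w) ≡ false
    new w rewrite splitAt-↑ʳ N j w = refl

count-isNew : count (not ∘ isOld {N} {j}) ≡ j
count-isNew {N} {j} = +-cancelˡ-≡ N _ j (trans (cong (_+ count (not ∘ isOld {N} {j})) (sym count-isOld))
                                               (trans (count-split (λ _ → true) (isOld {N} {j})) count-all))

module _ (G : Graph N) (j : ℕ) (M : PerfectMatching (addUniversal G j)) where

  private
    p = partner M
    isOld′ = isOld {N} {j}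

  oldMate : Fin N → Bool
  oldMate u = isOld′ (p (u ↑ˡ j))

  mate : Fin N → Fin N
  mate u = [ (λ v → v) , const u ] (splitAt N (p (u ↑ˡ j)))

  perfectOn-oldMate : PerfectOn G oldMate mate
  perfectOn-oldMate u old with splitAt N (p (u ↑ˡ j)) in split
  ... | inj₁ v = matched v split
    where
      matched : ∀ v → splitAt N (p (u ↑ˡ j)) ≡ inj₁ v → oldMate v ≡ true × mate v ≡ u × Adj G u v ≡ true
      matched v split = trans (cong isOld′ pv≡u) (cong [ const true , const false ] (splitAt-↑ˡ N u j)) ,
                        trans (cong (λ x → [ (λ w → w) , const v ] (splitAt N x)) pv≡u)
                              (cong [ (λ w → w) , const v ] (splitAt-↑ˡ N u j)) ,
                        subst₂ (λ x y → joinAdj (Adj G) x y ≡ true) (splitAt-↑ˡ N u j) split (partner-adjacent M (u ↑ˡ j))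
        where
          pv≡u : p (v ↑ˡ j) ≡ u ↑ˡ j
          pv≡u = trans (cong p (sym (trans (sym (join-splitAt N j (p (u ↑ˡ j)))) (cong (join N j) split))))
                       (partner-involutive M (u ↑ˡ j))

  -- The partner map is a bijection, so at most j old vertices have new partners.
  count-oldMate : N ≤ count oldMate + j
  count-oldMate = begin
    N                                                            ≡⟨ count-isOld {N} {j} ⟨
    count isOld′                                                 ≡⟨ count-split isOld′ (isOld′ ∘ p) ⟨
    count (λ x → isOld′ x ∧ isOld′ (p x)) + count (λ x → isOld′ x ∧ not (isOld′ (p x)))
      ≤⟨ +-mono-≤ (≤-reflexive oldOld) (≤-trans (≤-reflexive (count-involution p (partner-involutive M))) (count-mono toNew)) ⟩
    count oldMate + count (not ∘ isOld′)                         ≡⟨ cong (count oldMate +_) (count-isNew {N} {j}) ⟩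
    count oldMate + j                                            ∎
    where
      open ≤-Reasoning
      oldOld : count (λ x → isOld′ x ∧ isOld′ (p x)) ≡ count oldMate
      oldOld = trans (sum-++ {N} {j} (λ x → ⟦ isOld′ x ∧ isOld′ (p x) ⟧))
                     (trans (cong₂ _+_ (count-cong old) (count-none new)) (+-identityʳ _))
        where
          old : ∀ u → isOld′ (u ↑ˡ j) ∧ isOld′ (p (u ↑ˡ j)) ≡ oldMate u
          old u rewrite splitAt-↑ˡ N u j = refl
          new : ∀ w → isOld′ (N ↑ʳ w) ∧ isOld′ (p (N ↑ʳ w)) ≡ false
          new w rewrite splitAt-↑ʳ N j w = refl
      toNew : ∀ x → isOld′ (p x) ∧ not (isOld′ (p (p x))) ≡ true → not (isOld′ x) ≡ true
      toNew x pair rewrite partner-involutive M x = proj₂ (∧-true⁻ pair)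

matching-addUniversal : (G : Graph N) (j : ℕ) → PerfectMatching (addUniversal G j) →
  ∃[ k ] Matching⊎ G k × N ≤ k + k + j
matching-addUniversal {N} G j M
  with k , (M′ , _) , count≡ ← matching⊎-perfectOn G (oldMate G j M) (perfectOn-oldMate G j M) =
  k , M′ , subst (λ n → N ≤ n + j) count≡ (count-oldMate G j M)

new-adjacent : (G : Graph N) (j : ℕ) {w : Fin j} {x : Fin (N + j)} → x ≢ N ↑ʳ w → Adj (addUniversal G j) (N ↑ʳ w) x ≡ true
new-adjacent {N} G j {w} {x} x≢new rewrite splitAt-↑ʳ N j w with splitAt N x in split
... | inj₁ _ = refl
... | inj₂ w′ = cong not (≢⇒==-false w≢w′)
  where
    w≢w′ : w ≢ w′
    w≢w′ refl = x≢new (trans (sym (join-splitAt N j x)) (cong (join N j) split))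

pick : (O : Fin n → Bool) {t : ℕ} → t ≤ count O → Σ (Fin n → Bool) λ P → count (λ c → O c ∧ P c) ≡ t
pick O {zero} _ = (λ _ → false) , count-none (λ c → ∧-zeroʳ (O c))
pick {suc n} O {suc t} t<count with O zero
... | true with P , picked ← pick (O ∘ suc) (≤-pred t<count) =
  (true ∷ P) , cong suc picked
... | false with P , picked ← pick (O ∘ suc) t<count =
  (false ∷ P) , picked

record Separation (G : Graph N) (s j : ℕ) : Set where
  field
    X Y : Fin N → Bool
    disjoint : ∀ i → X i ≡ true → Y i ≡ false
    no-edge : ∀ {i i′} → X i ≡ true → Y i′ ≡ true → Adj G i i′ ≡ false
    total : s + count X + count Y ≡ N
    X-large : s + j < count X + count X
    Y-large : s + j < count Y + count Y
    XY-large : 2 + (s + j) ≤ count X + count Y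

module _ (G : Graph N) (j : ℕ) (obstruction : TutteObstruction (addUniversal G j)) where

  open TutteObstruction obstruction renaming (S to S⁺; label to ℓ⁺)

  S : Fin N → Bool
  S u = S⁺ (u ↑ˡ j)

  ℓ : Fin N → Fin (N + j)
  ℓ u = ℓ⁺ (u ↑ˡ j)

  private
    -- A new vertex outside S⁺ would be adjacent to every other vertex outside S⁺, leaving at most one
    -- nonempty class.
    new-in-S : ∀ w → S⁺ (N ↑ʳ w) ≡ true
    new-in-S w with S⁺ (N ↑ʳ w) in Su
    ... | true = refl
    ... | false = contradiction (≤-trans many-odd (count-at-most-one (ℓ⁺ u) empty)) λ { (s≤s ()) }
      where
        u = N ↑ʳ w
        same : ∀ k → S⁺ k ≡ false → ℓ⁺ u ≡ ℓ⁺ k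
        same k Sk with k ≟ u
        ... | yes refl = refl
        ... | no k≢u = label-adjacent Su Sk (new-adjacent G j k≢u)
        empty : ∀ c → c ≢ ℓ⁺ u → odd (classSize (λ _ → true) S⁺ ℓ⁺ c) ≡ false
        empty c c≢ℓu = cong odd (count-none outside)
          where
            outside : ∀ k → not (S⁺ k) ∧ (ℓ⁺ k == c) ≡ false
            outside k with S⁺ k in Sk
            ... | true = refl
            ... | false = ≢⇒==-false (λ ℓk≡c → c≢ℓu (trans (sym ℓk≡c) (sym (same k Sk))))

    count-S⁺ : count S⁺ ≡ count S + j
    count-S⁺ = trans (sum-++ {N} {j} (λ x → ⟦ S⁺ x ⟧))
                     (cong (count S +_) (trans (count-cong new-in-S) count-all))

    classSize-old : ∀ c → classSize (λ _ → true) S⁺ ℓ⁺ c ≡ classSize (λ _ → true) S ℓ c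
    classSize-old c = trans (sum-++ {N} {j} (λ x → ⟦ not (S⁺ x) ∧ (ℓ⁺ x == c) ⟧))
                            (trans (cong (classSize (λ _ → true) S ℓ c +_) (count-none new)) (+-identityʳ _))
      where
        new : ∀ w → not (S⁺ (N ↑ʳ w)) ∧ (ℓ⁺ (N ↑ʳ w) == c) ≡ false
        new w rewrite new-in-S w = refl

    O : Fin (N + j) → Bool
    O c = odd (classSize (λ _ → true) S ℓ c)

    many-odd-old : 2 + (count S + j) ≤ count O
    many-odd-old = subst₂ (λ s q → 2 + s ≤ q) count-S⁺ (count-cong (cong odd ∘ classSize-old)) many-odd

    odd-classes-inhabited : ∀ (F : Fin (N + j) → Bool) → count (λ c → O c ∧ F c) ≤ count (λ u → not (S u) ∧ F (ℓ u))
    odd-classes-inhabited F = begin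
      count (λ c → O c ∧ F c)                                              ≤⟨ sum-mono-≤ inhabited ⟩
      sum (λ c → sum (λ u → ⟦ (not (S u) ∧ (ℓ u == c)) ∧ F c ⟧))
        ≡⟨ ∑-comm (λ c u → ⟦ (not (S u) ∧ (ℓ u == c)) ∧ F c ⟧) ⟩
      sum (λ u → sum (λ c → ⟦ (not (S u) ∧ (ℓ u == c)) ∧ F c ⟧))          ≡⟨ sum-cong-≗ (λ u → sum-cong-≗ (reorder u)) ⟩
      sum (λ u → sum (λ c → ⟦ (not (S u) ∧ F (ℓ u)) ∧ (ℓ u == c) ⟧))
        ≡⟨ sum-cong-≗ (λ u → sum-indicator-== (ℓ u) _) ⟩
      count (λ u → not (S u) ∧ F (ℓ u))                                    ∎
      where
        open ≤-Reasoning
        reorder : ∀ u c → ⟦ (not (S u) ∧ (ℓ u == c)) ∧ F c ⟧ ≡ ⟦ (not (S u) ∧ F (ℓ u)) ∧ (ℓ u == c) ⟧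
        reorder u c with ℓ u ≟ c
        ... | yes refl = cong ⟦_⟧ (trans (cong (_∧ F (ℓ u)) (∧-identityʳ (not (S u)))) (sym (∧-identityʳ _)))
        ... | no _ = cong ⟦_⟧ (trans (cong (_∧ F c) (∧-zeroʳ (not (S u)))) (sym (∧-zeroʳ _)))
        inhabited : ∀ c → ⟦ O c ∧ F c ⟧ ≤ sum (λ u → ⟦ (not (S u) ∧ (ℓ u == c)) ∧ F c ⟧)
        inhabited c with O c in Oc | F c
        ... | false | _ = z≤n
        ... | true | false = z≤n
        ... | true | true = subst (0 <_) (sum-cong-≗ (λ u → cong ⟦_⟧ (sym (∧-identityʳ (not (S u) ∧ (ℓ u == c)))))) (odd⇒pos Oc)

  separation : Separation G (count S) j
  separation = record
    { X = X ; Y = Y ; disjoint = disjoint ; no-edge = no-edge ; total = total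
    ; X-large = <-≤-trans Q-large (≤-trans Q≤⌈⌉+⌈⌉ (+-mono-≤ X-count X-count))
    ; Y-large = ≤-trans (≤-pred (≤-trans Q-large′ (n≤1+⌊n/2⌋+⌊n/2⌋ Q))) (+-mono-≤ Y-count Y-count)
    ; XY-large = ≤-trans many-odd-old (≤-trans (≤-reflexive (trans (sym (⌊n/2⌋+⌈n/2⌉≡n Q)) (+-comm ℕ.⌊ Q /2⌋ ℕ.⌈ Q /2⌉)))
                                               (+-mono-≤ X-count Y-count))
    }
    where
      Q = count O
      P = proj₁ (pick O (⌊n/2⌋≤n Q))
      X Y : Fin N → Bool
      X u = not (S u) ∧ not (P (ℓ u))
      Y u = not (S u) ∧ P (ℓ u)
      Y-count : ℕ.⌊ Q /2⌋ ≤ count Y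
      Y-count = subst (_≤ count Y) (proj₂ (pick O (⌊n/2⌋≤n Q))) (odd-classes-inhabited P)
      X-count : ℕ.⌈ Q /2⌉ ≤ count X
      X-count = subst (_≤ count X) rest (odd-classes-inhabited (not ∘ P))
        where
          rest : count (λ c → O c ∧ not (P c)) ≡ ℕ.⌈ Q /2⌉
          rest = +-cancelˡ-≡ ℕ.⌊ Q /2⌋ _ _
            (trans (cong (_+ count (λ c → O c ∧ not (P c))) (sym (proj₂ (pick O (⌊n/2⌋≤n Q)))))
                   (trans (count-split O P) (sym (⌊n/2⌋+⌈n/2⌉≡n Q))))
      Q-large : count S + j < Q
      Q-large = ≤-trans (n≤1+n _) many-odd-old
      Q-large′ : suc (suc (count S + j)) ≤ Q
      Q-large′ = many-odd-old
      Q≤⌈⌉+⌈⌉ : Q ≤ ℕ.⌈ Q /2⌉ + ℕ.⌈ Q /2⌉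
      Q≤⌈⌉+⌈⌉ = subst (_≤ ℕ.⌈ Q /2⌉ + ℕ.⌈ Q /2⌉) (⌊n/2⌋+⌈n/2⌉≡n Q) (+-monoˡ-≤ _ (⌊n/2⌋≤⌈n/2⌉ Q))
      disjoint : ∀ u → X u ≡ true → Y u ≡ false
      disjoint u Xu with S u | P (ℓ u)
      ... | true | _ = refl
      ... | false | false = refl
      no-edge : ∀ {u v} → X u ≡ true → Y v ≡ true → Adj G u v ≡ false
      no-edge {u} {v} Xu Yv with Adj G u v in uv
      ... | false = refl
      ... | true = contradiction (trans (sym (proj₂ (∧-true⁻ Xu))) (cong not (trans (cong P same-label) (proj₂ (∧-true⁻ Yv))))) λ ()
        where
          same-label : ℓ u ≡ ℓ v
          same-label = label-adjacent (not-true⁻ (proj₁ (∧-true⁻ Xu))) (not-true⁻ (proj₁ (∧-true⁻ Yv)))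
                                      (subst₂ (λ x y → joinAdj (Adj G) x y ≡ true) (sym (splitAt-↑ˡ N u j)) (sym (splitAt-↑ˡ N v j)) uv)
      total : count S + count X + count Y ≡ N
      total = begin
        count S + count X + count Y     ≡⟨ +-assoc (count S) _ _ ⟩
        count S + (count X + count Y)   ≡⟨ cong (count S +_) (trans (+-comm (count X) _) (count-split (not ∘ S) (P ∘ ℓ))) ⟩
        count S + count (not ∘ S)       ≡⟨ trans (count-split (λ _ → true) S) count-all ⟩
        N                               ∎
        where open ≡-Reasoning

-- Rational estimates

↑≡mkℚ : ∀ a → ↑ a ≡ mkℚ (ℤ.+ a) 0 (Coprime.sym (1-coprimeTo a))
↑≡mkℚ a = ℚ.normalize-coprime (Coprime.sym (1-coprimeTo a))

↑-+ : ∀ a b → ↑ (a + b) ≡ ↑ a ℚ.+ ↑ b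
↑-+ a b rewrite ↑≡mkℚ a | ↑≡mkℚ b =
  cong (ℚ._/ 1) (trans (ℤ.pos-+ a b) (cong₂ ℤ._+_ (sym (ℤ.*-identityʳ (ℤ.+ a))) (sym (ℤ.*-identityʳ (ℤ.+ b)))))

↑-* : ∀ a b → ↑ (a * b) ≡ ↑ a ℚ.* ↑ b
↑-* a b rewrite ↑≡mkℚ a | ↑≡mkℚ b = cong (ℚ._/ 1) (sym (ℤ.+◃n≡+n (a * b)))

↑-mono : ∀ {a b} → a ≤ b → ↑ a ℚ.≤ ↑ b
↑-mono {a} {b} a≤b rewrite ↑≡mkℚ a | ↑≡mkℚ b =
  ℚ.*≤* (subst₂ ℤ._≤_ (sym (ℤ.*-identityʳ (ℤ.+ a))) (sym (ℤ.*-identityʳ (ℤ.+ b))) (ℤ.+≤+ a≤b))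

↑-cancel : ∀ {a b} → ↑ a ℚ.≤ ↑ b → a ≤ b
↑-cancel {a} {b} ↑a≤↑b rewrite ↑≡mkℚ a | ↑≡mkℚ b =
  ℤ.drop‿+≤+ (subst₂ ℤ._≤_ (ℤ.*-identityʳ (ℤ.+ a)) (ℤ.*-identityʳ (ℤ.+ b)) (ℚ.drop-*≤* ↑a≤↑b))

↑-pos : ∀ {a} → 0 < a → 0ℚ ℚ.< ↑ a
↑-pos {a} 0<a rewrite ↑≡mkℚ a = ℚ.*<* (subst (ℤ._<_ _) (sym (ℤ.*-identityʳ (ℤ.+ a))) (ℤ.+<+ 0<a))

↑-nonNeg : ∀ a → 0ℚ ℚ.≤ ↑ a
↑-nonNeg a = ↑-mono {0} {a} z≤n

square-≤⇒≤ : ∀ {u v : ℚ} → 0ℚ ℚ.≤ v → u ℚ.* u ℚ.≤ v ℚ.* v → u ℚ.≤ v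
square-≤⇒≤ {u} {v} 0≤v uu≤vv = ℚ.≮⇒≥ v≮u
  where
    v≮u : ¬ (v ℚ.< u)
    v≮u v<u = ℚ.<-irrefl refl (ℚ.<-≤-trans (ℚ.≤-<-trans vv≤vu vu<uu) uu≤vv)
      where
        instance
          v-nonNeg : NonNegative v
          v-nonNeg = nonNegative 0≤v
          u-pos : Positive u
          u-pos = positive (ℚ.≤-<-trans 0≤v v<u)
        vv≤vu : v ℚ.* v ℚ.≤ v ℚ.* u
        vv≤vu = ℚ.*-monoˡ-≤-nonNeg v (ℚ.<⇒≤ v<u)
        vu<uu : v ℚ.* u ℚ.< u ℚ.* u
        vu<uu = ℚ.*-monoˡ-<-pos u v<u

-- Bounding each factor x/(s+x), y/(s+y) of the ratio in the weak condition by b/a bounds the ratio by (b/a)².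
ratio-bound : {β : ℚ} → 0ℚ ℚ.≤ β → ∀ {s x y a b : ℕ} → 0 < x → 0 < y →
  b * (s + x) ≤ a * x → b * (s + y) ≤ a * y →
  ↑ (x * y) ℚ.≤ (β ℚ.* β) ℚ.* ↑ ((s + y) * (s + x)) → ↑ b ℚ.≤ β ℚ.* ↑ a
ratio-bound {β} 0≤β {s} {x} {y} {a} {b} 0<x 0<y bx ay weak =
  square-≤⇒≤ 0≤βa (ℚ.*-cancelʳ-≤-pos D (begin
    (B ℚ.* B) ℚ.* D                       ≡⟨ cong (ℚ._* D) (↑-* b b) ⟨
    ↑ (b * b) ℚ.* D                       ≡⟨ ↑-* (b * b) _ ⟨
    ↑ (b * b * ((s + y) * (s + x)))       ≤⟨ ↑-mono nat ⟩
    ↑ (a * a * (x * y))                   ≡⟨ trans (↑-* (a * a) (x * y)) (cong (ℚ._* ↑ (x * y)) (↑-* a a)) ⟩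
    (A ℚ.* A) ℚ.* ↑ (x * y)               ≤⟨ ℚ.*-monoˡ-≤-nonNeg (A ℚ.* A) weak ⟩
    (A ℚ.* A) ℚ.* ((β ℚ.* β) ℚ.* D)
      ≡⟨ solve 3 (λ A β D → (A :* A) :* ((β :* β) :* D) := ((β :* A) :* (β :* A)) :* D) refl A β D ⟩
    ((β ℚ.* A) ℚ.* (β ℚ.* A)) ℚ.* D       ∎))
  where
    open ℚ.≤-Reasoning
    open +-*-Solver
    A = ↑ a
    B = ↑ b
    D = ↑ ((s + y) * (s + x))
    nat : b * b * ((s + y) * (s + x)) ≤ a * a * (x * y)
    nat = subst₂ _≤_ (rearrange b s x y) (rearrange′ a x y) (*-mono-≤ bx ay)
      where
        rearrange : ∀ b s x y → b * (s + x) * (b * (s + y)) ≡ b * b * ((s + y) * (s + x))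
        rearrange = solve-∀
        rearrange′ : ∀ a x y → a * x * (a * y) ≡ a * a * (x * y)
        rearrange′ = solve-∀
    instance
      D-pos : Positive D
      D-pos = positive (↑-pos (*-mono-≤ (≤-trans 0<y (m≤n+m y s)) (≤-trans 0<x (m≤n+m x s))))
      AA-nonNeg : NonNegative (A ℚ.* A)
      AA-nonNeg = nonNegative (subst (0ℚ ℚ.≤_) (↑-* a a) (↑-nonNeg (a * a)))
    0≤βa : 0ℚ ℚ.≤ β ℚ.* A
    0≤βa = subst (ℚ._≤ β ℚ.* A) (ℚ.*-zeroˡ A) (ℚ.*-monoʳ-≤-nonNeg A {{nonNegative (↑-nonNeg a)}} 0≤β)

module _ (β : ℚ) (0<β : 0ℚ ℚ.< β) where

  private
    instance
      β-pos : Positive β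
      β-pos = positive 0<β
      1+β-pos : Positive (1ℚ ℚ.+ β)
      1+β-pos = ℚ.pos+pos⇒pos 1ℚ β
      1+β-nonZero : NonZero (1ℚ ℚ.+ β)
      1+β-nonZero = ℚ.pos⇒nonZero (1ℚ ℚ.+ β)
      w-nonNeg : NonNegative (1/ (1ℚ ℚ.+ β))
      w-nonNeg = ℚ.pos⇒nonNeg (1/ (1ℚ ℚ.+ β)) {{ℚ.1/pos⇒pos (1ℚ ℚ.+ β)}}

    w = 1/ (1ℚ ℚ.+ β)

  -- b ≤ β (n + r) with n = r + b rearranges to (1 - β) n ≤ (1 + β) r.
  bound-≤ : ∀ {n r b} → n ≡ r + b → ↑ b ℚ.≤ β ℚ.* ↑ (n + r) → bound β 0<β ℚ.* ↑ n ℚ.≤ ↑ r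
  bound-≤ {r = r} {b} refl b≤ = begin
    bound β 0<β ℚ.* ↑ (r + b)
      ≤⟨ ℚ.*-monoʳ-≤-nonNeg (↑ (r + b)) {{nonNegative (↑-nonNeg (r + b))}} (ℚ.p⊓q≤p ((1ℚ ℚ.- β) ℚ.* w) ½) ⟩
    ((1ℚ ℚ.- β) ℚ.* w) ℚ.* ↑ (r + b)            ≡⟨ cong (((1ℚ ℚ.- β) ℚ.* w) ℚ.*_) (↑-+ r b) ⟩
    ((1ℚ ℚ.- β) ℚ.* w) ℚ.* (R ℚ.+ B)
      ≡⟨ solve 4 (λ β w R B → ((con 1ℚ :- β) :* w) :* (R :+ B) := ((con 1ℚ :- β) :* (R :+ B)) :* w) refl β w R B ⟩
    ((1ℚ ℚ.- β) ℚ.* (R ℚ.+ B)) ℚ.* w            ≤⟨ ℚ.*-monoʳ-≤-nonNeg w key ⟩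
    (R ℚ.* (1ℚ ℚ.+ β)) ℚ.* w                    ≡⟨ ℚ.*-assoc R _ w ⟩
    R ℚ.* ((1ℚ ℚ.+ β) ℚ.* w)                    ≡⟨ cong (R ℚ.*_) (ℚ.*-inverseʳ (1ℚ ℚ.+ β)) ⟩
    R ℚ.* 1ℚ                                    ≡⟨ ℚ.*-identityʳ R ⟩
    R                                           ∎
    where
      open ℚ.≤-Reasoning
      open +-*-Solver
      R = ↑ r
      B = ↑ b
      b≤′ : B ℚ.≤ β ℚ.* (R ℚ.+ B ℚ.+ R)
      b≤′ = subst (λ q → B ℚ.≤ β ℚ.* q) (trans (↑-+ (r + b) r) (cong (ℚ._+ R) (↑-+ r b))) b≤
      key : (1ℚ ℚ.- β) ℚ.* (R ℚ.+ B) ℚ.≤ R ℚ.* (1ℚ ℚ.+ β)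
      key = subst₂ ℚ._≤_
        (solve 3 (λ β R B → B :+ (R :- β :* (R :+ B)) := (con 1ℚ :- β) :* (R :+ B)) refl β R B)
        (solve 3 (λ β R B → β :* (R :+ B :+ R) :+ (R :- β :* (R :+ B)) := R :* (con 1ℚ :+ β)) refl β R B)
        (ℚ.+-monoˡ-≤ (R ℚ.- β ℚ.* (R ℚ.+ B)) b≤′)

  bound-≤-½ : bound β 0<β ℚ.≤ ½
  bound-≤-½ = ℚ.p⊓q≤q ((1ℚ ℚ.- β) ℚ.* w) ½

  bound-≡-½ : β ℚ.≤ ℤ.+ 1 ℚ./ 3 → bound β 0<β ≡ ½
  bound-≡-½ β≤⅓ = ℚ.p≥q⇒p⊓q≡q {(1ℚ ℚ.- β) ℚ.* w} (ℚ.*-cancelʳ-≤-pos (1ℚ ℚ.+ β) (begin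
    ½ ℚ.* (1ℚ ℚ.+ β)
      ≡⟨ solve 1 (λ β → con ½ :* (con 1ℚ :+ β) := con (ℤ.+ 3 ℚ./ 2) :* β :+ (con ½ :- β)) refl β ⟩
    (ℤ.+ 3 ℚ./ 2) ℚ.* β ℚ.+ (½ ℚ.- β)
      ≤⟨ ℚ.+-monoˡ-≤ (½ ℚ.- β) (ℚ.*-monoˡ-≤-nonNeg (ℤ.+ 3 ℚ./ 2) β≤⅓) ⟩
    (ℤ.+ 3 ℚ./ 2) ℚ.* (ℤ.+ 1 ℚ./ 3) ℚ.+ (½ ℚ.- β)
      ≡⟨ solve 1 (λ β → con (ℤ.+ 3 ℚ./ 2) :* con (ℤ.+ 1 ℚ./ 3) :+ (con ½ :- β) := con 1ℚ :- β) refl β ⟩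
    1ℚ ℚ.- β                                                ≡⟨ ℚ.*-identityʳ _ ⟨
    (1ℚ ℚ.- β) ℚ.* 1ℚ                                       ≡⟨ cong ((1ℚ ℚ.- β) ℚ.*_) (ℚ.*-inverseˡ (1ℚ ℚ.+ β)) ⟨
    (1ℚ ℚ.- β) ℚ.* (w ℚ.* (1ℚ ℚ.+ β))                       ≡⟨ ℚ.*-assoc (1ℚ ℚ.- β) w _ ⟨
    (1ℚ ℚ.- β) ℚ.* w ℚ.* (1ℚ ℚ.+ β)                         ∎))
    where
      open ℚ.≤-Reasoning
      open +-*-Solver

½*↑≤↑⇔ : ∀ {n k} → ½ ℚ.* ↑ n ℚ.≤ ↑ k ⇔ n ≤ k + k
½*↑≤↑⇔ {n} {k} = mk⇔
  (λ ½n≤k → ↑-cancel (begin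
    ↑ n                          ≡⟨ solve 1 (λ n → n := (con 1ℚ :+ con 1ℚ) :* (con ½ :* n)) refl (↑ n) ⟩
    (1ℚ ℚ.+ 1ℚ) ℚ.* (½ ℚ.* ↑ n)  ≤⟨ ℚ.*-monoˡ-≤-nonNeg (1ℚ ℚ.+ 1ℚ) ½n≤k ⟩
    (1ℚ ℚ.+ 1ℚ) ℚ.* ↑ k          ≡⟨ solve 1 (λ k → (con 1ℚ :+ con 1ℚ) :* k := k :+ k) refl (↑ k) ⟩
    ↑ k ℚ.+ ↑ k                  ≡⟨ ↑-+ k k ⟨
    ↑ (k + k)                    ∎))
  (λ n≤2k → begin
    ½ ℚ.* ↑ n                    ≤⟨ ℚ.*-monoˡ-≤-nonNeg ½ (↑-mono n≤2k) ⟩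
    ½ ℚ.* ↑ (k + k)              ≡⟨ cong (½ ℚ.*_) (↑-+ k k) ⟩
    ½ ℚ.* (↑ k ℚ.+ ↑ k)          ≡⟨ solve 1 (λ k → con ½ :* (k :+ k) := k) refl (↑ k) ⟩
    ↑ k                          ∎)
  where
    open ℚ.≤-Reasoning
    open +-*-Solver

tabulate-∈ : (P : Fin n → Bool) {i : Fin n} → i ∈ tabulate P → P i ≡ true
tabulate-∈ P {i} i∈ = trans (sym (lookup∘tabulate P i)) ([]=⇒lookup i∈)

∣tabulate∣ : (P : Fin n → Bool) → ∣ tabulate P ∣ ≡ count P
∣tabulate∣ {zero} P = refl
∣tabulate∣ {suc n} P with P zero
... | true = cong suc (∣tabulate∣ (P ∘ suc))
... | false = ∣tabulate∣ (P ∘ suc)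

tabulate-≢⊤ : (P : Fin n → Bool) {i : Fin n} → P i ≡ false → tabulate P ≢ ⊤
tabulate-≢⊤ P {i} Pi P≡⊤ with () ← trans (sym Pi)
  (trans (sym (lookup∘tabulate P i)) (trans (cong (λ v → lookup v i) P≡⊤) (lookup-replicate i true)))

module _ {G : Graph N} {s j : ℕ} (separation : Separation G s j) where

  open Separation separation

  private
    half-pos : ∀ {z} → s + j < z + z → 0 < z
    half-pos {suc z} _ = z<s

  X-nonempty : 0 < count X
  X-nonempty = half-pos X-large

  Y-nonempty : 0 < count Y
  Y-nonempty = half-pos Y-large

  separation-s≤r : ∀ {r} → j + (suc r + suc r) ≡ N → s ≤ r
  separation-s≤r {r} N≡ = double-≤-cancel (+-cancelʳ-≤ (2 + j) _ _ (begin
    s + s + (2 + j)                 ≡⟨ e₁ s j ⟩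
    s + (2 + (s + j))               ≤⟨ +-monoʳ-≤ s XY-large ⟩
    s + (count X + count Y)         ≡⟨ +-assoc s _ _ ⟨
    s + count X + count Y           ≡⟨ trans total (sym N≡) ⟩
    j + (suc r + suc r)             ≡⟨ e₂ j r ⟩
    r + r + (2 + j)                 ∎))
    where
      open ≤-Reasoning
      e₁ : ∀ s j → s + s + (2 + j) ≡ s + (2 + (s + j))
      e₁ = solve-∀
      e₂ : ∀ j r → j + (suc r + suc r) ≡ r + r + (2 + j)
      e₂ = solve-∀

  separation-weak : ∀ {β} → WeaklyGraph N G β →
    ↑ (count X * count Y) ℚ.≤ (β ℚ.* β) ℚ.* ↑ ((s + count Y) * (s + count X))
  separation-weak {β} weak =
    subst (λ q → ↑ (count X * count Y) ℚ.≤ (β ℚ.* β) ℚ.* ↑ q) (cong₂ _*_ N∸x N∸y)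
      (subst₂ (λ x y → ↑ (x * y) ℚ.≤ (β ℚ.* β) ℚ.* ↑ ((N ∸ x) * (N ∸ y))) (∣tabulate∣ X) (∣tabulate∣ Y)
        (weak (tabulate X) (tabulate Y) X≢⊤ Y≢⊤
              (λ i i∈X i∈Y → contradiction (trans (sym (tabulate-∈ Y i∈Y)) (disjoint i (tabulate-∈ X i∈X))) λ ())
              (λ i i′ i∈X i′∈Y → no-edge (tabulate-∈ X i∈X) (tabulate-∈ Y i′∈Y))))
    where
      X≢⊤ : tabulate X ≢ ⊤
      X≢⊤ with i , Yi ← count-witness {P = Y} Y-nonempty = tabulate-≢⊤ X (outside (X i) refl)
        where
          outside : ∀ b → X i ≡ b → X i ≡ false
          outside true Xi with () ← trans (sym Yi) (disjoint i Xi)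
          outside false Xi = Xi
      Y≢⊤ : tabulate Y ≢ ⊤
      Y≢⊤ with i , Xi ← count-witness {P = X} X-nonempty = tabulate-≢⊤ Y (disjoint i Xi)
      swap : ∀ s x y → s + x + y ≡ s + y + x
      swap = solve-∀
      N∸x : N ∸ count X ≡ s + count Y
      N∸x = trans (cong (_∸ count X) (trans (sym total) (swap s (count X) (count Y))))
                  (m+n∸n≡m (s + count Y) (count X))
      N∸y : N ∸ count Y ≡ s + count X
      N∸y = trans (cong (_∸ count Y) (sym total)) (m+n∸n≡m (s + count X) (count Y))

-- With n = r + b and a = n + r this is b·s ≤ 2r·z, i.e. z/(s + z) ≥ b/a.
side-bound : ∀ {s j r z} → s ≤ r → s + j < z + z → suc (r + j) * (s + z) ≤ (r + suc (r + j) + r) * z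
side-bound {s} {j} {r} {z} s≤r large = begin
  suc (r + j) * (s + z)                        ≡⟨ e₁ r j s z ⟩
  s * r + s * suc j + suc (r + j) * z          ≤⟨ +-monoˡ-≤ _ (+-monoʳ-≤ (s * r) (*-monoˡ-≤ (suc j) s≤r)) ⟩
  s * r + r * suc j + suc (r + j) * z          ≡⟨ e₂ r j s z ⟩
  r * suc (s + j) + suc (r + j) * z            ≤⟨ +-monoˡ-≤ _ (*-monoʳ-≤ r large) ⟩
  r * (z + z) + suc (r + j) * z                ≡⟨ e₃ r j z ⟩
  (r + suc (r + j) + r) * z                    ∎
  where
    open ≤-Reasoning
    e₁ : ∀ r j s z → suc (r + j) * (s + z) ≡ s * r + s * suc j + suc (r + j) * z
    e₁ = solve-∀
    e₂ : ∀ r j s z → s * r + r * suc j + suc (r + j) * z ≡ r * suc (s + j) + suc (r + j) * z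
    e₂ = solve-∀
    e₃ : ∀ r j z → r * (z + z) + suc (r + j) * z ≡ (r + suc (r + j) + r) * z
    e₃ = solve-∀

module _ (G : Graph N) {t : ℚ} (separated : ∀ {s j r} → j + (suc r + suc r) ≡ N → Separation G s j → t ℚ.≤ ↑ r) where

  large-matching : ∀ r j → j + (r + r) ≡ N → t ℚ.≤ ↑ r → ∃[ k ] Matching⊎ G k × t ℚ.≤ ↑ k
  large-matching zero _ _ t≤0 = 0 , matching⊎-empty , t≤0
  large-matching (suc r) j N≡ t≤r with tutte even (addUniversal G j)
    where
      even : odd (N + j) ≡ false
      even = trans (cong odd (trans (cong (_+ j) (sym N≡)) (rearrange j r))) (odd-double (j + suc r))
        where
          rearrange : ∀ j r → j + (suc r + suc r) + j ≡ j + suc r + (j + suc r)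
          rearrange = solve-∀
  ... | inj₁ M with k , M′ , N≤ ← matching-addUniversal G j M =
    k , M′ , ℚ.≤-trans t≤r (↑-mono (double-≤-cancel {suc r} {k} (+-cancelʳ-≤ j (suc r + suc r) (k + k)
                 (subst (_≤ k + k + j) (trans (sym N≡) (+-comm j (suc r + suc r))) N≤))))
  ... | inj₂ obstruction = large-matching r (j + 2) N≡′ (separated N≡ (separation G j obstruction))
    where
      N≡′ : j + 2 + (r + r) ≡ N
      N≡′ = trans (rearrange j r) N≡
        where
          rearrange : ∀ j r → j + 2 + (r + r) ≡ j + (suc r + suc r)
          rearrange = solve-∀

module Main (β : ℚ) (0<β : 0ℚ ℚ.< β) (n : ℕ) (G : Graph (suc n)) (weak : WeaklyGraph (suc n) G β) where

  target : ℚ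
  target = bound β 0<β ℚ.* ↑ n

  separation-bound : ∀ {s j r} → j + (suc r + suc r) ≡ suc n → Separation G s j → target ℚ.≤ ↑ r
  separation-bound {s} {j} {r} N≡ separation =
    bound-≤ β 0<β n≡ (subst (λ m → ↑ (suc (r + j)) ℚ.≤ β ℚ.* ↑ (m + r)) (sym n≡)
      (ratio-bound (ℚ.<⇒≤ 0<β) {s} {count X} {count Y} {r + suc (r + j) + r} {suc (r + j)}
                   (X-nonempty separation) (Y-nonempty separation)
                   (side-bound {s} {j} {r} {count X} s≤r X-large) (side-bound {s} {j} {r} {count Y} s≤r Y-large)
                   (separation-weak separation {β} weak)))
    where
      open Separation separation
      s≤r = separation-s≤r separation N≡
      n≡ : n ≡ r + suc (r + j)
      n≡ = suc-injective (trans (sym N≡) (rearrange j r))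
        where
          rearrange : ∀ j r → j + (suc r + suc r) ≡ suc (r + suc (r + j))
          rearrange = solve-∀

  half : ℕ
  half = ℕ.⌊ suc n /2⌋

  -- Opaque so that type-checking never unfolds the search for the matching.
  opaque
    best : ∃[ k ] Matching⊎ G k × target ℚ.≤ ↑ k
    best = large-matching G separation-bound half (suc n ∸ (half + half)) (m∸n+n≡m half+half≤N)
      (ℚ.≤-trans (ℚ.*-monoʳ-≤-nonNeg (↑ n) {{nonNegative (↑-nonNeg n)}} (bound-≤-½ β 0<β))
                 (Equivalence.from (½*↑≤↑⇔ {n} {half}) (≤-pred (n≤1+⌊n/2⌋+⌊n/2⌋ (suc n)))))
      where
        half+half≤N : half + half ≤ suc n
        half+half≤N = ≤-trans (+-monoʳ-≤ half (⌊n/2⌋≤⌈n/2⌉ (suc n))) (≤-reflexive (⌊n/2⌋+⌈n/2⌉≡n (suc n)))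

  perfect : ∀ m → suc n ≡ 2 * m → β ℚ.≤ ℤ.+ 1 ℚ./ 3 → Matching G m
  perfect m N≡2m β≤⅓ with k , M , target≤k ← best = toMatching (matching⊎-truncate M m≤k)
    where
      n≤2k : n ≤ k + k
      n≤2k = Equivalence.to (½*↑≤↑⇔ {n} {k}) (subst (λ c → c ℚ.* ↑ n ℚ.≤ ↑ k) (bound-≡-½ β 0<β β≤⅓) target≤k)
      m≤k : m ≤ k
      m≤k = ≮⇒≥ λ k<m → 1+n≰n (begin
        suc (suc (k + k))   ≡⟨ cong suc (+-suc k k) ⟨
        suc k + suc k       ≤⟨ +-mono-≤ k<m k<m ⟩
        m + m               ≡⟨ trans (cong (m +_) (sym (+-identityʳ m))) (sym N≡2m) ⟩
        suc n               ≤⟨ s≤s n≤2k ⟩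
        suc (k + k)         ∎)
        where open ≤-Reasoning

theorem3p3 : (β : ℚ) → (0<β : 0ℚ ℚ.< β) → (n : ℕ) → (G : Graph (suc n)) →
    WeaklyGraph (suc n) G β →
    MatchingNumberAtLeast G (bound β 0<β ℚ.* ↑ n)
    × (∀ m → suc n ≡ 2 * m → β ℚ.≤ ℤ.+ 1 ℚ./ 3 → Matching G m)
theorem3p3 β 0<β n G weak with k , M , target≤k ← Main.best β 0<β n G weak =
  (k , toMatching M , target≤k) , Main.perfect β 0<β n G weak
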